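{- Let $R$ be a commutative integral domain of characteristic $0$. Every $u\in R\langle X,Y\rangle$ can be written as $$u=\sum_{\mathbf{k}\in\mathbb{N}_0^{(\infty)}}\langle \mathsf{S}^{(\mathbf{k})},u\rangle\,\mathsf{M}^{(\mathbf{k})}=\sum_{\mathbf{k}\in\mathbb{N}_0^{(\infty)}}\langle \mathsf{M}^{(\mathbf{k})},u\rangle\,\mathsf{S}^{(\mathbf{k})},$$ where only finitely many summands are nonzero in each sum.
   Context: $\mathbb{N}_0^{(\infty)}$ is the set of tuples $\mathbf{k}=(k_1,\dots,k_d;k_\infty)$, $d\ge0$, of non-negative integers. $w_{\mathbf{k}}=X^{k_1}Y\cdots X^{k_d}YX^{k_\infty}$; these are all words (monomials) in $X,Y$. The standard pairing $\langle\,,\rangle$ is the $R$-bilinear form making distinct words orthogonal and each word of pairing $1$ with itself. $Y^{(0)}=Y$, $Y^{(k+1)}=XY^{(k)}-Y^{(k)}X$; $\mathsf{M}^{(\mathbf{k})}=Y^{(k_1)}\cdots Y^{(k_d)}X^{k_\infty}$. With $\sqcup\!\sqcup$ the shuffle product, $\mathsf{S}^{(;k)}=X^k$, and for $d\ge1$: $P_1=X^{k_1}Y$, $P_i=(P_{i-1}\sqcup\!\sqcup X^{k_i})Y$ ($i=2,\dots,d$), $\mathsf{S}^{(\mathbf{k})}=P_d\sqcup\!\sqcup X^{k_\infty}$. -}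

module Defs where

open import Level using (_⊔_)
open import Algebra.Bundles using (CommutativeRing)
open import Data.Nat using (ℕ; zero; suc)
open import Data.List using (List; []; _∷_; _++_; map; concatMap; replicate; foldr)
open import Data.Product using (_×_; _,_; ∃)
open import Data.Sum using (_⊎_)
open import Relation.Nullary using (¬_; yes; no)
open import Relation.Binary.PropositionalEquality using (_≡_; refl)
open import Relation.Binary.Definitions using (DecidableEquality)
import Data.List.Properties as LP
open import Data.List.Membership.Propositional using (_∉_)
open import Data.List.Relation.Unary.Unique.Propositional using (Unique)

data Letter : Set where
  X Y : Letter

_≟L_ : DecidableEquality Letter
X ≟L X = yes refl
X ≟L Y = no λ ()
Y ≟L X = no λ ()
Y ≟L Y = yes refl

Word : Set
Word = List Letter

_≟W_ : DecidableEquality Word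
_≟W_ = LP.≡-dec _≟L_

-- Shuffle of two words, as the list of all shuffles counted with multiplicity.
shuffleW : Word → Word → List Word
shuffleW [] w = w ∷ []
shuffleW (a ∷ v) [] = (a ∷ v) ∷ []
shuffleW (a ∷ v) (b ∷ w) = map (a ∷_) (shuffleW v (b ∷ w)) ++ map (b ∷_) (shuffleW (a ∷ v) w)

-- Index set N_0^(∞): tuples (k_1,...,k_d ; k_∞), d ≥ 0.
Index : Set
Index = List ℕ × ℕ

IsIntegralDomain : ∀ {c ℓ} → CommutativeRing c ℓ → Set (c ⊔ ℓ)
IsIntegralDomain R = ¬ (1# ≈ 0#) × (∀ a b → a * b ≈ 0# → a ≈ 0# ⊎ b ≈ 0#)
  where open CommutativeRing R

module _ {c ℓ} (R : CommutativeRing c ℓ) where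
  open CommutativeRing R
  natR : ℕ → Carrier
  natR zero = 0#
  natR (suc n) = 1# + natR n

CharZero : ∀ {c ℓ} → CommutativeRing c ℓ → Set ℓ
CharZero R = ∀ n → natR R n ≈ 0# → n ≡ 0
  where open CommutativeRing R

-- Noncommutative polynomials R⟨X,Y⟩ as formal finite R-linear combinations
-- of words; equality is equality of all coefficients.
module Over {c ℓ} (R : CommutativeRing c ℓ) where
  open CommutativeRing R

  Poly : Set c
  Poly = List (Carrier × Word)

  0P : Poly
  0P = []

  1P : Poly
  1P = (1# , []) ∷ []

  _+P_ : Poly → Poly → Poly
  p +P q = p ++ q

  _·P_ : Carrier → Poly → Poly
  a ·P p = map (λ { (b , w) → (a * b , w) }) p

  -P_ : Poly → Poly
  -P p = (- 1#) ·P p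

  _*P_ : Poly → Poly → Poly
  p *P q = concatMap (λ { (a , v) → map (λ { (b , w) → (a * b , v ++ w) }) q }) p

  _ш_ : Poly → Poly → Poly
  p ш q = concatMap (λ { (a , v) → concatMap (λ { (b , w) → map (λ u → (a * b , u)) (shuffleW v w) }) q }) p

  coeff : Poly → Word → Carrier
  coeff [] w = 0#
  coeff ((a , v) ∷ p) w with v ≟W w
  ... | yes _ = a + coeff p w
  ... | no _ = coeff p w

  _≈P_ : Poly → Poly → Set ℓ
  p ≈P q = ∀ w → coeff p w ≈ coeff q w

  ⟨_,_⟩ : Poly → Poly → Carrier
  ⟨ p , q ⟩ = foldr (λ { (a , v) s → a * coeff q v + s }) 0# p

  ΣP : List Index → (Index → Poly) → Poly
  ΣP L f = concatMap f L

  Xp Yp : Poly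
  Xp = (1# , X ∷ []) ∷ []
  Yp = (1# , Y ∷ []) ∷ []

  X^ : ℕ → Poly
  X^ k = (1# , replicate k X) ∷ []

  Y⁽_⁾ : ℕ → Poly
  Y⁽ zero ⁾ = Yp
  Y⁽ suc k ⁾ = (Xp *P Y⁽ k ⁾) +P (-P (Y⁽ k ⁾ *P Xp))

  M : Index → Poly
  M (ks , k∞) = foldr (λ k p → Y⁽ k ⁾ *P p) 1P ks *P X^ k∞

  -- P_1 = X^{k_1} Y,  P_i = (P_{i-1} ш X^{k_i}) Y
  Pstep : Poly → List ℕ → Poly
  Pstep p [] = p
  Pstep p (k ∷ ks) = Pstep ((p ш X^ k) *P Yp) ks

  S : Index → Poly
  S ([] , k∞) = X^ k∞
  S (k₁ ∷ ks , k∞) = Pstep (X^ k₁ *P Yp) ks ш X^ k∞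

  -- "u = Σ_k f k with only finitely many nonzero summands":
  -- there is a finite duplicate-free list L of indices outside of which every
  -- summand is the zero polynomial, and u equals the sum over L.
  FinSumRep : Poly → (Index → Poly) → Set ℓ
  FinSumRep u f = ∃ λ (L : List Index) →
    Unique L × (∀ k → k ∉ L → f k ≈P 0P) × (u ≈P ΣP L f)

module Submission where

-- Every index 𝐤 has a weight, the length of w_𝐤, and S 𝐤 and M 𝐤 are homogeneous of that
-- degree, so it suffices to work in a fixed length n. There the coefficient matrices of the
-- S 𝐤 and of the M 𝐤 are mutually inverse:
--   Σ_{weight 𝐤 = |w|} ⟨S 𝐤, w⟩ ⟨M 𝐤, v⟩ = δ_{v,w}.
-- This is proved by induction on w from the right, stripping its last letter c with the right
-- derivative ∂ c, the adjoint of right multiplication by c. By the Leibniz rule for ш, the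
-- associativity of ш and X^j ш X^b = C(j+b, j) X^(j+b), ∂ X lowers k_∞ by one and ∂ Y sends
-- S (k₁,…,k_d ; b) to C(k_d + b, k_d) S (k₁,…,k_{d-1} ; k_d + b). Dually, M 𝐤 X raises k_∞,
-- and X Y⁽ʲ⁾ = Y⁽ʲ⁺¹⁾ + Y⁽ʲ⁾ X gives M (ks ; a) Y = Σ_{j+b=a} C(j+b, j) M (ks, j ; b), so both
-- sides obey the same recursion. The identity is symmetric in v and w, which gives both
-- expansions. Only the commutativity of R is used: all coefficients are integers.
-- Polynomials are compared through the linear forms eval p F = Σ a_w F(w), which turn
-- products and shuffles into nested sums over words.

open import Defs
open import Level using (Level; _⊔_)
open import Algebra.Bundles using (Semiring; CommutativeRing)
open import Data.Empty using (⊥-elim)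
open import Data.List using (List; []; _∷_; _++_; map; concatMap; replicate; _∷ʳ_; length; foldr)
import Data.List.Properties as List
open import Data.List.Membership.Propositional using (_∈_; _∉_)
open import Data.List.Membership.Propositional.Properties using (∈-map⁺; ∈-++⁺ˡ; ∈-++⁺ʳ; ∈-concatMap⁺; ∈-concatMap⁻)
open import Data.List.Relation.Unary.All as All using (All; []; _∷_)
import Data.List.Relation.Unary.All.Properties as All
open import Data.List.Relation.Unary.Any as Any using (here; there)
open import Data.List.Relation.Unary.Unique.Propositional using (Unique; []; _∷_)
import Data.List.Relation.Unary.Unique.Propositional.Properties as Unique
open import Data.List.Reverse using (Reverse; []; _∶_∶ʳ_; reverseView)
open import Data.Nat as ℕ using (ℕ; zero; suc; _≤_; _<_)
import Data.Nat.Properties as ℕ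
open import Data.Product using (_×_; _,_; proj₁; proj₂)
open import Data.Sum using (inj₁; inj₂)
open import Function using (_∘_)
open import Relation.Binary.Bundles using (Setoid)
open import Relation.Binary.PropositionalEquality as ≡ using (_≡_; _≢_)
open import Relation.Nullary using (¬_; yes; no)
import Relation.Binary.Reasoning.Setoid as SetoidReasoning

∷ʳ≢[] : ∀ {a} {A : Set a} (xs : List A) {x} → xs ∷ʳ x ≢ []
∷ʳ≢[] []      ()
∷ʳ≢[] (_ ∷ _) ()

antidiagonal : ℕ → List (ℕ × ℕ)
antidiagonal zero    = (0 , 0) ∷ []
antidiagonal (suc a) = (0 , suc a) ∷ map (λ (j , b) → (suc j , b)) (antidiagonal a)

antidiagonal-sum : ∀ a → All (λ (j , b) → j ℕ.+ b ≡ a) (antidiagonal a)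
antidiagonal-sum zero    = ≡.refl ∷ []
antidiagonal-sum (suc a) = ≡.refl ∷ All.map⁺ (All.map (≡.cong suc) (antidiagonal-sum a))

∈-antidiagonal : ∀ j b → (j , b) ∈ antidiagonal (j ℕ.+ b)
∈-antidiagonal zero    zero    = here ≡.refl
∈-antidiagonal zero    (suc b) = here ≡.refl
∈-antidiagonal (suc j) b       = there (∈-map⁺ _ (∈-antidiagonal j b))

antidiagonal-unique : ∀ a → Unique (antidiagonal a)
antidiagonal-unique zero    = [] ∷ []
antidiagonal-unique (suc a) =
  All.map⁺ (All.universal (λ _ ()) (antidiagonal a)) ∷
  Unique.map⁺ (λ e → ≡.cong₂ _,_ (ℕ.suc-injective (≡.cong proj₁ e)) (≡.cong proj₂ e)) (antidiagonal-unique a)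

Unique-concatMap⁺ : ∀ {a b} {A : Set a} {B : Set b} {f : A → List B} (parent : B → A) →
                    (∀ x → All (λ y → parent y ≡ x) (f x)) → (∀ x → Unique (f x)) →
                    ∀ {L} → Unique L → Unique (concatMap f L)
Unique-concatMap⁺ parent f-parent f-unique []              = []
Unique-concatMap⁺ {f = f} parent f-parent f-unique {x ∷ L} (x∉L ∷ L!) =
  Unique.++⁺ (f-unique x) (Unique-concatMap⁺ parent f-parent f-unique L!) disjoint
  where
  disjoint : ∀ {y} → ¬ (y ∈ f x × y ∈ concatMap f L)
  disjoint {y} (y∈fx , y∈fL) = All.lookup x∉L x∈L ≡.refl
    where
    x∈L : x ∈ L
    x∈L = ≡.subst (_∈ L) (All.lookup (f-parent x) y∈fx)
            (Any.map (λ {z} y∈fz → All.lookup (f-parent z) y∈fz) (∈-concatMap⁻ f y∈fL))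

weightᴸ : List ℕ → ℕ
weightᴸ []       = 0
weightᴸ (k ∷ ks) = suc (k ℕ.+ weightᴸ ks)

weight : Index → ℕ
weight (ks , b) = weightᴸ ks ℕ.+ b

weight-∷ʳ : ∀ ks j b → weight (ks ∷ʳ j , b) ≡ suc (weight (ks , j ℕ.+ b))
weight-∷ʳ ks j b = begin
  weightᴸ (ks ∷ʳ j) ℕ.+ b       ≡⟨ ≡.cong (ℕ._+ b) (weightᴸ-∷ʳ ks) ⟩
  weightᴸ ks ℕ.+ suc j ℕ.+ b    ≡⟨ ℕ.+-assoc (weightᴸ ks) (suc j) b ⟩
  weightᴸ ks ℕ.+ suc (j ℕ.+ b)  ≡⟨ ℕ.+-suc (weightᴸ ks) (j ℕ.+ b) ⟩
  suc (weightᴸ ks ℕ.+ (j ℕ.+ b)) ∎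
  where
  open ≡.≡-Reasoning
  weightᴸ-∷ʳ : ∀ ks → weightᴸ (ks ∷ʳ j) ≡ weightᴸ ks ℕ.+ suc j
  weightᴸ-∷ʳ []       = ≡.cong suc (ℕ.+-identityʳ j)
  weightᴸ-∷ʳ (k ∷ ks) = ≡.cong suc (≡.trans (≡.cong (k ℕ.+_) (weightᴸ-∷ʳ ks)) (≡.sym (ℕ.+-assoc k _ _)))

-- Every index of weight n + 1 other than ([] , n + 1) arises from exactly one index (ks , a) of
-- weight n by splitting a = j + b into (ks ∷ʳ j , b).
children : Index → List Index
children (ks , a) = map (λ (j , b) → (ks ∷ʳ j , b)) (antidiagonal a)

parent : Index → Index
parent ([] , b)          = ([] , b)
parent (k ∷ [] , b)      = ([] , k ℕ.+ b)
parent (k ∷ k′ ∷ ks , b) = (k ∷ proj₁ (parent (k′ ∷ ks , b)) , proj₂ (parent (k′ ∷ ks , b)))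

parent-∷ʳ : ∀ ks j b → parent (ks ∷ʳ j , b) ≡ (ks , j ℕ.+ b)
parent-∷ʳ []            j b = ≡.refl
parent-∷ʳ (k ∷ [])      j b = ≡.refl
parent-∷ʳ (k ∷ k′ ∷ ks) j b rewrite parent-∷ʳ (k′ ∷ ks) j b = ≡.refl

indices : ℕ → List Index
indices zero    = ([] , 0) ∷ []
indices (suc n) = ([] , suc n) ∷ concatMap children (indices n)

indices-weight : ∀ n → All (λ k → weight k ≡ n) (indices n)
indices-weight zero    = ≡.refl ∷ []
indices-weight (suc n) = ≡.refl ∷ All.concat⁺ (All.map⁺ (All.map children-weight (indices-weight n)))
  where
  children-weight : ∀ {k} → weight k ≡ n → All (λ y → weight y ≡ suc n) (children k)
  children-weight {ks , a} ≡.refl = All.map⁺ (All.map (λ {(j , b)} j+b≡a →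
    ≡.trans (weight-∷ʳ ks j b) (≡.cong (λ m → suc (weightᴸ ks ℕ.+ m)) j+b≡a)) (antidiagonal-sum a))

∈-indices : ∀ k → k ∈ indices (weight k)
∈-indices (ks , b) = go ks (reverseView ks) b
  where
  go : ∀ ks → Reverse ks → ∀ b → (ks , b) ∈ indices (weight (ks , b))
  go .[] []      zero    = here ≡.refl
  go .[] []      (suc b) = here ≡.refl
  go .(ks ∷ʳ j) (ks ∶ rks ∶ʳ j) b rewrite weight-∷ʳ ks j b =
    there (∈-concatMap⁺ children (Any.map (λ { ≡.refl → ∈-map⁺ _ (∈-antidiagonal j b) }) (go ks rks (j ℕ.+ b))))

indices-unique : ∀ n → Unique (indices n)
indices-unique zero    = [] ∷ []
indices-unique (suc n) =
  All.concat⁺ (All.map⁺ (All.universal children-nonempty (indices n))) ∷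
  Unique-concatMap⁺ parent children-parent children-unique (indices-unique n)
  where
  children-nonempty : ∀ k → All (λ y → ([] , suc n) ≢ y) (children k)
  children-nonempty (ks , a) = All.map⁺ (All.universal (λ (j , b) e → ∷ʳ≢[] ks (≡.sym (≡.cong proj₁ e))) _)
  children-parent : ∀ k → All (λ y → parent y ≡ k) (children k)
  children-parent (ks , a) = All.map⁺ (All.map (λ {(j , b)} j+b≡a →
    ≡.trans (parent-∷ʳ ks j b) (≡.cong (ks ,_) j+b≡a)) (antidiagonal-sum a))
  children-unique : ∀ k → Unique (children k)
  children-unique (ks , a) = Unique.map⁺
    (λ e → ≡.cong₂ _,_ (proj₂ (List.∷ʳ-injective ks ks (≡.cong proj₁ e))) (≡.cong proj₂ e)) (antidiagonal-unique a)

indices≤ : ℕ → List Index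
indices≤ zero    = indices 0
indices≤ (suc N) = indices (suc N) ++ indices≤ N

indices≤-weight : ∀ N → All (λ k → weight k ≤ N) (indices≤ N)
indices≤-weight zero    = All.map ℕ.≤-reflexive (indices-weight 0)
indices≤-weight (suc N) =
  All.++⁺ (All.map ℕ.≤-reflexive (indices-weight (suc N))) (All.map ℕ.m≤n⇒m≤1+n (indices≤-weight N))

∈-indices≤ : ∀ N k → weight k ≤ N → k ∈ indices≤ N
∈-indices≤ zero    k w≤0 = ≡.subst (λ n → k ∈ indices n) (ℕ.n≤0⇒n≡0 w≤0) (∈-indices k)
∈-indices≤ (suc N) k w≤N+1 with ℕ.m≤n⇒m<n∨m≡n w≤N+1
... | inj₁ w<N+1 = ∈-++⁺ʳ (indices (suc N)) (∈-indices≤ N k (ℕ.≤-pred w<N+1))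
... | inj₂ w≡N+1 = ∈-++⁺ˡ (≡.subst (λ n → k ∈ indices n) w≡N+1 (∈-indices k))

indices≤-unique : ∀ N → Unique (indices≤ N)
indices≤-unique zero    = indices-unique 0
indices≤-unique (suc N) = Unique.++⁺ (indices-unique (suc N)) (indices≤-unique N)
  λ (k∈ , k∈≤) → ℕ.<-irrefl ≡.refl
    (≡.subst (ℕ._≤ N) (All.lookup (indices-weight (suc N)) k∈) (All.lookup (indices≤-weight N) k∈≤))

replicate-∷ʳ : ∀ {a} {A : Set a} n (x : A) → replicate (suc n) x ≡ replicate n x ∷ʳ x
replicate-∷ʳ zero    x = ≡.refl
replicate-∷ʳ (suc n) x = ≡.cong (x ∷_) (replicate-∷ʳ n x)

quotientʳ : Letter → Word → List Word
quotientʳ c []          = []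
quotientʳ c (a ∷ [])    with a ≟L c
... | yes _ = [] ∷ []
... | no  _ = []
quotientʳ c (a ∷ b ∷ x) = map (a ∷_) (quotientʳ c (b ∷ x))

quotientʳ-∷ʳ : ∀ c u → quotientʳ c (u ∷ʳ c) ≡ u ∷ []
quotientʳ-∷ʳ c []          with c ≟L c
... | yes _   = ≡.refl
... | no  c≢c = ⊥-elim (c≢c ≡.refl)
quotientʳ-∷ʳ c (a ∷ [])    with c ≟L c
... | yes _   = ≡.refl
... | no  c≢c = ⊥-elim (c≢c ≡.refl)
quotientʳ-∷ʳ c (a ∷ b ∷ u) = ≡.cong (map (a ∷_)) (quotientʳ-∷ʳ c (b ∷ u))

quotientʳ-∷ʳ-≢ : ∀ {c c′} u → c′ ≢ c → quotientʳ c (u ∷ʳ c′) ≡ []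
quotientʳ-∷ʳ-≢ {c} {c′} []          c′≢c with c′ ≟L c
... | yes c′≡c = ⊥-elim (c′≢c c′≡c)
... | no  _    = ≡.refl
quotientʳ-∷ʳ-≢ {c} {c′} (a ∷ [])    c′≢c with c′ ≟L c
... | yes c′≡c = ⊥-elim (c′≢c c′≡c)
... | no  _    = ≡.refl
quotientʳ-∷ʳ-≢          (a ∷ b ∷ u) c′≢c = ≡.cong (map (a ∷_)) (quotientʳ-∷ʳ-≢ (b ∷ u) c′≢c)

∷-≢[] : ∀ {a} (L : List Word) → All (_≢ []) (map (a ∷_) L)
∷-≢[] L = All.map⁺ (All.universal (λ _ ()) L)

shuffleW-≢[]ʳ : ∀ u b t → All (_≢ []) (shuffleW u (b ∷ t))
shuffleW-≢[]ʳ []      b t = (λ ()) ∷ []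
shuffleW-≢[]ʳ (a ∷ u) b t = All.++⁺ (∷-≢[] (shuffleW u (b ∷ t))) (∷-≢[] (shuffleW (a ∷ u) t))

shuffleW-≢[]ˡ : ∀ a u t → All (_≢ []) (shuffleW (a ∷ u) t)
shuffleW-≢[]ˡ a u []      = (λ ()) ∷ []
shuffleW-≢[]ˡ a u (b ∷ t) = All.++⁺ (∷-≢[] (shuffleW u (b ∷ t))) (∷-≢[] (shuffleW (a ∷ u) t))

shuffleW-length : ∀ u t → All (λ x → length x ≡ length u ℕ.+ length t) (shuffleW u t)
shuffleW-length []      t       = ≡.refl ∷ []
shuffleW-length (a ∷ u) []      = ≡.sym (ℕ.+-identityʳ _) ∷ []
shuffleW-length (a ∷ u) (b ∷ t) = All.++⁺
  (All.map⁺ (All.map (≡.cong suc) (shuffleW-length u (b ∷ t))))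
  (All.map⁺ (All.map (λ e → ≡.cong suc (≡.trans e (≡.sym (ℕ.+-suc (length u) (length t))))) (shuffleW-length (a ∷ u) t)))

module ListSum {c ℓ} (R : Semiring c ℓ) where
  open Semiring R
  open import Algebra.Properties.CommutativeSemigroup +-commutativeSemigroup using (interchange)

  ∑ : ∀ {a} {A : Set a} → List A → (A → Carrier) → Carrier
  ∑ []       f = 0#
  ∑ (x ∷ xs) f = f x + ∑ xs f

  infix 5 ∑
  syntax ∑ L (λ x → e) = ∑[ x ← L ] e

  module _ {a} {A : Set a} where

    ∑-congᴬ : ∀ (L : List A) {f g : A → Carrier} → All (λ x → f x ≈ g x) L → ∑ L f ≈ ∑ L g
    ∑-congᴬ []       []       = refl
    ∑-congᴬ (x ∷ xs) (e ∷ es) = +-cong e (∑-congᴬ xs es)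

    ∑-cong : ∀ (L : List A) {f g : A → Carrier} → (∀ x → f x ≈ g x) → ∑ L f ≈ ∑ L g
    ∑-cong L e = ∑-congᴬ L (All.universal e L)

    ∑-zeroᴬ : ∀ (L : List A) {f : A → Carrier} → All (λ x → f x ≈ 0#) L → ∑ L f ≈ 0#
    ∑-zeroᴬ []       []       = refl
    ∑-zeroᴬ (x ∷ xs) (e ∷ es) = trans (+-cong e (∑-zeroᴬ xs es)) (+-identityʳ 0#)

    ∑-zero : ∀ (L : List A) {f : A → Carrier} → (∀ x → f x ≈ 0#) → ∑ L f ≈ 0#
    ∑-zero L e = ∑-zeroᴬ L (All.universal e L)

    ∑-++ : ∀ (xs ys : List A) (f : A → Carrier) → ∑ (xs ++ ys) f ≈ ∑ xs f + ∑ ys f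
    ∑-++ []       ys f = sym (+-identityˡ _)
    ∑-++ (x ∷ xs) ys f = trans (+-congˡ (∑-++ xs ys f)) (sym (+-assoc _ _ _))

    ∑-+ : ∀ (L : List A) (f g : A → Carrier) → ∑[ x ← L ] (f x + g x) ≈ ∑ L f + ∑ L g
    ∑-+ []       f g = sym (+-identityˡ 0#)
    ∑-+ (x ∷ xs) f g = trans (+-congˡ (∑-+ xs f g)) (interchange _ _ _ _)

    ∑-*ˡ : ∀ (L : List A) (a : Carrier) (f : A → Carrier) → ∑[ x ← L ] (a * f x) ≈ a * ∑ L f
    ∑-*ˡ []       a f = sym (zeroʳ a)
    ∑-*ˡ (x ∷ xs) a f = trans (+-congˡ (∑-*ˡ xs a f)) (sym (distribˡ a _ _))

  module _ {a b} {A : Set a} {B : Set b} where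

    ∑-map : ∀ (h : A → B) (L : List A) (f : B → Carrier) → ∑ (map h L) f ≈ ∑[ x ← L ] f (h x)
    ∑-map h []       f = refl
    ∑-map h (x ∷ xs) f = +-congˡ (∑-map h xs f)

    ∑-concatMap : ∀ (h : A → List B) (L : List A) (f : B → Carrier) →
                  ∑ (concatMap h L) f ≈ ∑[ x ← L ] ∑ (h x) f
    ∑-concatMap h []       f = refl
    ∑-concatMap h (x ∷ xs) f = trans (∑-++ (h x) (concatMap h xs) f) (+-congˡ (∑-concatMap h xs f))

    ∑-comm : ∀ (L : List A) (K : List B) (f : A → B → Carrier) →
             ∑[ x ← L ] ∑[ y ← K ] f x y ≈ ∑[ y ← K ] ∑[ x ← L ] f x y
    ∑-comm []       K f = sym (∑-zero K (λ _ → refl))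
    ∑-comm (x ∷ xs) K f = trans (+-congˡ (∑-comm xs K f)) (sym (∑-+ K (f x) _))

module Binomial {c ℓ} (R : Semiring c ℓ) where
  open Semiring R
  open ListSum R
  open SetoidReasoning setoid

  -- (j + b choose j), as an element of R
  binom : ℕ → ℕ → Carrier
  binom zero    b       = 1#
  binom (suc j) zero    = 1#
  binom (suc j) (suc b) = binom j (suc b) + binom (suc j) b

  binom-zeroʳ : ∀ j → binom j 0 ≈ 1#
  binom-zeroʳ zero    = refl
  binom-zeroʳ (suc j) = refl

  ∑ᵈ : ℕ → (ℕ → ℕ → Carrier) → Carrier
  ∑ᵈ a g = ∑[ p ← antidiagonal a ] g (proj₁ p) (proj₂ p)

  ∑ᵈ-suc : ∀ a g → ∑ᵈ (suc a) g ≈ g 0 (suc a) + ∑ᵈ a (λ j b → g (suc j) b)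
  ∑ᵈ-suc a g = +-congˡ (∑-map _ (antidiagonal a) _)

  ∑ᵈ-sucʳ : ∀ a g → ∑ᵈ (suc a) g ≈ ∑ᵈ a (λ j b → g j (suc b)) + g (suc a) 0
  ∑ᵈ-sucʳ zero    g = trans (+-congˡ (+-identityʳ _)) (+-congʳ (sym (+-identityʳ _)))
  ∑ᵈ-sucʳ (suc a) g = begin
    ∑ᵈ (suc (suc a)) g                                                   ≈⟨ ∑ᵈ-suc (suc a) g ⟩
    g 0 (suc (suc a)) + ∑ᵈ (suc a) (λ j b → g (suc j) b)                ≈⟨ +-congˡ (∑ᵈ-sucʳ a _) ⟩
    g 0 (suc (suc a)) + (∑ᵈ a (λ j b → g (suc j) (suc b)) + g (suc (suc a)) 0) ≈⟨ sym (+-assoc _ _ _) ⟩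
    (g 0 (suc (suc a)) + ∑ᵈ a (λ j b → g (suc j) (suc b))) + g (suc (suc a)) 0 ≈⟨ +-congʳ (sym (∑ᵈ-suc a _)) ⟩
    ∑ᵈ (suc a) (λ j b → g j (suc b)) + g (suc (suc a)) 0                ∎

  ∑ᵈ-congᵈ : ∀ a {g h : ℕ → ℕ → Carrier} → (∀ j b → j ℕ.+ b ≡ a → g j b ≈ h j b) → ∑ᵈ a g ≈ ∑ᵈ a h
  ∑ᵈ-congᵈ a e = ∑-congᴬ (antidiagonal a) (All.map (λ {(j , b)} → e j b) (antidiagonal-sum a))

  private
    shiftʲ shiftᵇ : (ℕ → ℕ → Carrier) → ℕ → ℕ → Carrier
    shiftʲ f zero    b = 0#
    shiftʲ f (suc j) b = f j b
    shiftᵇ f j zero    = 0#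
    shiftᵇ f j (suc b) = f j b

    ∑ᵈ-shiftʲ : ∀ a f → ∑ᵈ (suc a) (shiftʲ f) ≈ ∑ᵈ a f
    ∑ᵈ-shiftʲ a f = trans (∑ᵈ-suc a _) (+-identityˡ _)

    ∑ᵈ-shiftᵇ : ∀ a f → ∑ᵈ (suc a) (shiftᵇ f) ≈ ∑ᵈ a f
    ∑ᵈ-shiftᵇ a f = trans (∑ᵈ-sucʳ a _) (+-identityʳ _)

  pascal : ∀ a (H : ℕ → ℕ → Carrier) →
           ∑ᵈ (suc a) (λ j b → binom j b * H j b) ≈ ∑ᵈ a (λ j b → binom j b * (H (suc j) b + H j (suc b)))
  pascal a H = begin
    ∑ᵈ (suc a) (λ j b → binom j b * H j b)            ≈⟨ ∑ᵈ-congᵈ (suc a) split ⟩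
    ∑ᵈ (suc a) (λ j b → shiftʲ f j b + shiftᵇ g j b) ≈⟨ ∑-+ (antidiagonal (suc a)) _ _ ⟩
    ∑ᵈ (suc a) (shiftʲ f) + ∑ᵈ (suc a) (shiftᵇ g)    ≈⟨ +-cong (∑ᵈ-shiftʲ a f) (∑ᵈ-shiftᵇ a g) ⟩
    ∑ᵈ a f + ∑ᵈ a g                                    ≈⟨ sym (∑-+ (antidiagonal a) _ _) ⟩
    ∑ᵈ a (λ j b → f j b + g j b)                       ≈⟨ ∑-cong (antidiagonal a) (λ _ → sym (distribˡ _ _ _)) ⟩
    ∑ᵈ a (λ j b → binom j b * (H (suc j) b + H j (suc b))) ∎
    where
    f g : ℕ → ℕ → Carrier
    f j b = binom j b * H (suc j) b
    g j b = binom j b * H j (suc b)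
    split : ∀ j b → j ℕ.+ b ≡ suc a → binom j b * H j b ≈ shiftʲ f j b + shiftᵇ g j b
    split zero    (suc b) _ = trans (*-identityˡ _) (sym (trans (+-identityˡ _) (*-identityˡ _)))
    split (suc j) zero    _ = trans (*-congʳ (sym (binom-zeroʳ j))) (sym (+-identityʳ _))
    split (suc j) (suc b) _ = distribʳ _ _ _

module Evaluation {c ℓ} (R : CommutativeRing c ℓ) where
  open CommutativeRing R
  open Over R
  open ListSum semiring
  open Binomial semiring
  open SetoidReasoning setoid
  open import Algebra.Properties.CommutativeSemigroup +-commutativeSemigroup using (interchange)

  eval : Poly → (Word → Carrier) → Carrier
  eval p F = ∑[ e ← p ] proj₁ e * F (proj₂ e)

  eval-cong : ∀ p {F G : Word → Carrier} → (∀ u → F u ≈ G u) → eval p F ≈ eval p G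
  eval-cong p e = ∑-cong p (λ x → *-congˡ (e (proj₂ x)))

  eval-+ : ∀ p (F G : Word → Carrier) → eval p (λ u → F u + G u) ≈ eval p F + eval p G
  eval-+ p F G = trans (∑-cong p (λ x → distribˡ (proj₁ x) _ _)) (∑-+ p _ _)

  eval-*ˡ : ∀ p a (F : Word → Carrier) → eval p (λ u → a * F u) ≈ a * eval p F
  eval-*ˡ p a F = trans (∑-cong p (λ x → x∙yz≈y∙xz (proj₁ x) a _)) (∑-*ˡ p a _)
    where open import Algebra.Properties.CommutativeSemigroup *-commutativeSemigroup using (x∙yz≈y∙xz)

  eval-*ʳ : ∀ p a (F : Word → Carrier) → eval p (λ u → F u * a) ≈ eval p F * a
  eval-*ʳ p a F = trans (eval-cong p (λ u → *-comm (F u) a)) (trans (eval-*ˡ p a F) (*-comm a _))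

  eval-zero : ∀ p {F : Word → Carrier} → (∀ u → F u ≈ 0#) → eval p F ≈ 0#
  eval-zero p e = ∑-zero p (λ x → trans (*-congˡ (e (proj₂ x))) (zeroʳ _))

  eval-congᴬ : ∀ p {F G : Word → Carrier} → All (λ e → F (proj₂ e) ≈ G (proj₂ e)) p → eval p F ≈ eval p G
  eval-congᴬ p e = ∑-congᴬ p (All.map *-congˡ e)

  eval-zeroᴬ : ∀ p {F : Word → Carrier} → All (λ e → F (proj₂ e) ≈ 0#) p → eval p F ≈ 0#
  eval-zeroᴬ p e = ∑-zeroᴬ p (All.map (λ z → trans (*-congˡ z) (zeroʳ _)) e)

  eval-∑ : ∀ {a} {A : Set a} p (L : List A) (G : Word → A → Carrier) →
           eval p (λ u → ∑[ x ← L ] G u x) ≈ ∑[ x ← L ] eval p (λ u → G u x)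
  eval-∑ p L G = trans (∑-cong p (λ e → sym (∑-*ˡ L (proj₁ e) _))) (∑-comm p L _)

  eval-comm : ∀ p q (G : Word → Word → Carrier) →
              eval p (λ u → eval q (λ t → G u t)) ≈ eval q (λ t → eval p (λ u → G u t))
  eval-comm p q G = trans (eval-∑ p q _) (∑-cong q (λ e → eval-*ˡ p (proj₁ e) _))

  eval-+P : ∀ p q F → eval (p +P q) F ≈ eval p F + eval q F
  eval-+P p q F = ∑-++ p q _

  eval-·P : ∀ a p F → eval (a ·P p) F ≈ a * eval p F
  eval-·P a p F = trans (∑-map _ p _) (trans (∑-cong p (λ e → *-assoc a _ _)) (∑-*ˡ p a _))

  eval-*P : ∀ p q F → eval (p *P q) F ≈ eval p (λ u → eval q (λ t → F (u ++ t)))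
  eval-*P p q F = trans (∑-concatMap _ p _) (∑-cong p λ (a , v) →
    trans (∑-map _ q _) (trans (∑-cong q (λ e → *-assoc a _ _)) (∑-*ˡ q a _)))

  Sh : Word → Word → (Word → Carrier) → Carrier
  Sh u t F = ∑ (shuffleW u t) F

  eval-ш : ∀ p q F → eval (p ш q) F ≈ eval p (λ u → eval q (λ t → Sh u t F))
  eval-ш p q F = trans (∑-concatMap _ p _) (∑-cong p λ (a , v) →
    trans (∑-concatMap _ q _) (trans (∑-cong q λ (b , w) →
      trans (∑-map _ (shuffleW v w) _) (trans (∑-*ˡ (shuffleW v w) (a * b) F) (*-assoc a b _)))
    (∑-*ˡ q a _)))

  eval-X^ : ∀ n F → eval (X^ n) F ≈ F (replicate n X)
  eval-X^ n F = trans (+-identityʳ _) (*-identityˡ _)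

  eval-1P : ∀ F → eval 1P F ≈ F []
  eval-1P F = eval-X^ 0 F

  letter : Letter → Poly
  letter c = (1# , c ∷ []) ∷ []

  eval-letter-*P : ∀ c p F → eval (letter c *P p) F ≈ eval p (λ u → F (c ∷ u))
  eval-letter-*P c p F = trans (eval-*P (letter c) p F) (trans (+-identityʳ _) (*-identityˡ _))

  eval-*P-letter : ∀ p c F → eval (p *P letter c) F ≈ eval p (λ u → F (u ∷ʳ c))
  eval-*P-letter p c F = trans (eval-*P p (letter c) F) (eval-cong p (λ u → trans (+-identityʳ _) (*-identityˡ _)))

  infix 4 _≋_
  record _≋_ (p q : Poly) : Set (c ⊔ ℓ) where
    constructor mk≋
    field eval-≋ : ∀ F → eval p F ≈ eval q F
  open _≋_ public

  ≋-setoid : Setoid c (c ⊔ ℓ)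
  ≋-setoid = record
    { Carrier = Poly ; _≈_ = _≋_
    ; isEquivalence = record
      { refl = mk≋ λ F → refl
      ; sym = λ e → mk≋ λ F → sym (eval-≋ e F)
      ; trans = λ e e′ → mk≋ λ F → trans (eval-≋ e F) (eval-≋ e′ F) } }

  open Setoid ≋-setoid public using () renaming (refl to ≋-refl; sym to ≋-sym; trans to ≋-trans)
  module ≋-Reasoning = SetoidReasoning ≋-setoid

  δ : Word → Word → Carrier
  δ w u with u ≟W w
  ... | yes _ = 1#
  ... | no  _ = 0#

  δ-≡ : ∀ {w u} → u ≡ w → δ w u ≈ 1#
  δ-≡ {w} {u} u≡w with u ≟W w
  ... | yes _   = refl
  ... | no  u≢w = ⊥-elim (u≢w u≡w)

  δ-≢ : ∀ {w u} → u ≢ w → δ w u ≈ 0#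
  δ-≢ {w} {u} u≢w with u ≟W w
  ... | yes u≡w = ⊥-elim (u≢w u≡w)
  ... | no  _   = refl

  δ-comm : ∀ v w → δ v w ≈ δ w v
  δ-comm v w with w ≟W v
  ... | yes w≡v = sym (δ-≡ (≡.sym w≡v))
  ... | no  w≢v = sym (δ-≢ (w≢v ∘ ≡.sym))

  coeff-eval : ∀ p w → coeff p w ≈ eval p (δ w)
  coeff-eval []            w = refl
  coeff-eval ((a , v) ∷ p) w with v ≟W w
  ... | yes _ = +-cong (sym (*-identityʳ a)) (coeff-eval p w)
  ... | no  _ = trans (coeff-eval p w) (sym (trans (+-congʳ (zeroʳ a)) (+-identityˡ _)))

  ≋⇒≈P : ∀ {p q} → p ≋ q → p ≈P q
  ≋⇒≈P {p} {q} e w = trans (coeff-eval p w) (trans (eval-≋ e (δ w)) (sym (coeff-eval q w)))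

  coeff-·P : ∀ a p w → coeff (a ·P p) w ≈ a * coeff p w
  coeff-·P a p w = trans (coeff-eval (a ·P p) w) (trans (eval-·P a p (δ w)) (*-congˡ (sym (coeff-eval p w))))

  coeff-ΣP : ∀ L f v → coeff (ΣP L f) v ≈ ∑[ k ← L ] coeff (f k) v
  coeff-ΣP L f v = trans (coeff-eval (ΣP L f) v)
    (trans (∑-concatMap f L _) (∑-cong L (λ k → sym (coeff-eval (f k) v))))

  pairing-eval : ∀ p q → ⟨ p , q ⟩ ≈ eval p (coeff q)
  pairing-eval []      q = refl
  pairing-eval (_ ∷ p) q = +-congˡ (pairing-eval p q)

  pairing-evalʳ : ∀ p q → ⟨ p , q ⟩ ≈ eval q (coeff p)
  pairing-evalʳ p q = begin
    ⟨ p , q ⟩                        ≈⟨ pairing-eval p q ⟩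
    eval p (coeff q)                 ≈⟨ eval-cong p (coeff-eval q) ⟩
    eval p (λ x → eval q (δ x))      ≈⟨ eval-comm p q δ ⟩
    eval q (λ y → eval p (λ x → δ x y)) ≈⟨ eval-cong q (λ y → eval-cong p (λ x → δ-comm x y)) ⟩
    eval q (λ y → eval p (δ y))      ≈⟨ eval-cong q (λ y → sym (coeff-eval p y)) ⟩
    eval q (coeff p)                 ∎

  +P-cong : ∀ {p p′ q q′} → p ≋ p′ → q ≋ q′ → p +P q ≋ p′ +P q′
  +P-cong {p} {p′} {q} {q′} e e′ = mk≋ λ F → begin
    eval (p +P q) F       ≈⟨ eval-+P p q F ⟩
    eval p F + eval q F   ≈⟨ +-cong (eval-≋ e F) (eval-≋ e′ F) ⟩
    eval p′ F + eval q′ F ≈⟨ eval-+P p′ q′ F ⟨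
    eval (p′ +P q′) F     ∎

  +P-identityʳ : ∀ p → p +P 0P ≋ p
  +P-identityʳ p = mk≋ λ F → trans (eval-+P p 0P F) (+-identityʳ _)

  ·P-cong : ∀ a {p q} → p ≋ q → a ·P p ≋ a ·P q
  ·P-cong a {p} {q} e = mk≋ λ F → trans (eval-·P a p F) (trans (*-congˡ (eval-≋ e F)) (sym (eval-·P a q F)))

  *P-congˡ : ∀ {p p′} q → p ≋ p′ → p *P q ≋ p′ *P q
  *P-congˡ {p} {p′} q e = mk≋ λ F → trans (eval-*P p q F) (trans (eval-≋ e _) (sym (eval-*P p′ q F)))

  *P-congʳ : ∀ p {q q′} → q ≋ q′ → p *P q ≋ p *P q′
  *P-congʳ p {q} {q′} e = mk≋ λ F →
    trans (eval-*P p q F) (trans (eval-cong p (λ u → eval-≋ e _)) (sym (eval-*P p q′ F)))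

  *P-assoc : ∀ p q r → (p *P q) *P r ≋ p *P (q *P r)
  *P-assoc p q r = mk≋ λ F → begin
    eval ((p *P q) *P r) F                                            ≈⟨ eval-*P (p *P q) r F ⟩
    eval (p *P q) (λ u → eval r (λ s → F (u ++ s)))                   ≈⟨ eval-*P p q _ ⟩
    eval p (λ u → eval q (λ t → eval r (λ s → F ((u ++ t) ++ s))))
      ≈⟨ eval-cong p (λ u → eval-cong q (λ t → eval-cong r (λ s → reflexive (≡.cong F (List.++-assoc u t s))))) ⟩
    eval p (λ u → eval q (λ t → eval r (λ s → F (u ++ (t ++ s)))))   ≈⟨ eval-cong p (λ u → eval-*P q r _) ⟨
    eval p (λ u → eval (q *P r) (λ v → F (u ++ v)))                   ≈⟨ eval-*P p (q *P r) F ⟨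
    eval (p *P (q *P r)) F                                            ∎

  *P-distribʳ : ∀ p q r → (p +P q) *P r ≋ (p *P r) +P (q *P r)
  *P-distribʳ p q r = mk≋ λ F → begin
    eval ((p +P q) *P r) F                                 ≈⟨ eval-*P (p +P q) r F ⟩
    eval (p +P q) (λ u → eval r (λ t → F (u ++ t)))        ≈⟨ eval-+P p q _ ⟩
    _ + _                                                  ≈⟨ +-cong (eval-*P p r F) (eval-*P q r F) ⟨
    eval (p *P r) F + eval (q *P r) F                      ≈⟨ eval-+P (p *P r) (q *P r) F ⟨
    eval ((p *P r) +P (q *P r)) F                          ∎

  *P-identityˡ : ∀ p → 1P *P p ≋ p
  *P-identityˡ p = mk≋ λ F → trans (eval-*P 1P p F) (eval-1P (λ u → eval p (λ t → F (u ++ t))))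

  *P-identityʳ : ∀ p → p *P 1P ≋ p
  *P-identityʳ p = mk≋ λ F → trans (eval-*P p 1P F)
    (eval-cong p (λ u → trans (eval-1P (λ t → F (u ++ t))) (reflexive (≡.cong F (List.++-identityʳ u)))))

  ш-congˡ : ∀ {p p′} q → p ≋ p′ → p ш q ≋ p′ ш q
  ш-congˡ {p} {p′} q e = mk≋ λ F → trans (eval-ш p q F) (trans (eval-≋ e _) (sym (eval-ш p′ q F)))

  ш-congʳ : ∀ p {q q′} → q ≋ q′ → p ш q ≋ p ш q′
  ш-congʳ p {q} {q′} e = mk≋ λ F →
    trans (eval-ш p q F) (trans (eval-cong p (λ u → eval-≋ e _)) (sym (eval-ш p q′ F)))

  ш-zeroʳ : ∀ p → p ш 0P ≋ 0P
  ш-zeroʳ p = mk≋ λ F → trans (eval-ш p 0P F) (eval-zero p (λ _ → refl))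

  ш-identityˡ : ∀ p → 1P ш p ≋ p
  ш-identityˡ p = mk≋ λ F → trans (eval-ш 1P p F)
    (trans (eval-1P (λ u → eval p (λ t → Sh u t F))) (eval-cong p (λ t → +-identityʳ (F t))))

  ш-·Pʳ : ∀ p a q → p ш (a ·P q) ≋ a ·P (p ш q)
  ш-·Pʳ p a q = mk≋ λ F → begin
    eval (p ш (a ·P q)) F                        ≈⟨ eval-ш p (a ·P q) F ⟩
    eval p (λ u → eval (a ·P q) (λ t → Sh u t F)) ≈⟨ eval-cong p (λ u → eval-·P a q _) ⟩
    eval p (λ u → a * eval q (λ t → Sh u t F))    ≈⟨ eval-*ˡ p a _ ⟩
    a * eval p (λ u → eval q (λ t → Sh u t F))    ≈⟨ *-congˡ (eval-ш p q F) ⟨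
    a * eval (p ш q) F                           ≈⟨ eval-·P a (p ш q) F ⟨
    eval (a ·P (p ш q)) F                        ∎

  Sh-[]ˡ : ∀ t F → Sh [] t F ≈ F t
  Sh-[]ˡ t F = +-identityʳ _

  Sh-[]ʳ : ∀ u F → Sh u [] F ≈ F u
  Sh-[]ʳ []      F = +-identityʳ _
  Sh-[]ʳ (_ ∷ _) F = +-identityʳ _

  Sh-∷ : ∀ a u b t F → Sh (a ∷ u) (b ∷ t) F ≈ Sh u (b ∷ t) (λ x → F (a ∷ x)) + Sh (a ∷ u) t (λ x → F (b ∷ x))
  Sh-∷ a u b t F = trans (∑-++ (map (a ∷_) (shuffleW u (b ∷ t))) _ F)
                         (+-cong (∑-map (a ∷_) (shuffleW u (b ∷ t)) F) (∑-map (b ∷_) (shuffleW (a ∷ u) t) F))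

  -- Both sides obey the same three-term recursion in the first letters of u, t and s.
  Sh-assoc : ∀ u t s F → ∑[ x ← shuffleW u t ] Sh x s F ≈ ∑[ y ← shuffleW t s ] Sh u y F
  Sh-assoc []      t       s       F = trans (+-identityʳ _) (sym (∑-cong (shuffleW t s) (λ y → Sh-[]ˡ y F)))
  Sh-assoc (a ∷ u) []      s       F = refl
  Sh-assoc (a ∷ u) (b ∷ t) []      F =
    trans (∑-cong (shuffleW (a ∷ u) (b ∷ t)) (λ x → Sh-[]ʳ x F)) (sym (+-identityʳ _))
  Sh-assoc (a ∷ u) (b ∷ t) (e ∷ s) F = begin
    ∑[ x ← shuffleW (a ∷ u) (b ∷ t) ] Sh x (e ∷ s) F
      ≈⟨ Sh-∷ a u b t _ ⟩
    (∑[ x ← shuffleW u (b ∷ t) ] Sh (a ∷ x) (e ∷ s) F) + (∑[ x ← shuffleW (a ∷ u) t ] Sh (b ∷ x) (e ∷ s) F)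
      ≈⟨ +-cong (trans (∑-cong (shuffleW u (b ∷ t)) (λ x → Sh-∷ a x e s F)) (∑-+ (shuffleW u (b ∷ t)) _ _))
                (trans (∑-cong (shuffleW (a ∷ u) t) (λ x → Sh-∷ b x e s F)) (∑-+ (shuffleW (a ∷ u) t) _ _)) ⟩
    (L₁ + Lₐ) + (L₂ + Lᵦ)   ≈⟨ interchange _ _ _ _ ⟩
    (L₁ + L₂) + (Lₐ + Lᵦ)
      ≈⟨ +-cong (+-cong (Sh-assoc u (b ∷ t) (e ∷ s) Fₐ) (Sh-assoc (a ∷ u) t (e ∷ s) Fᵦ))
                (trans (sym (Sh-∷ a u b t _)) (Sh-assoc (a ∷ u) (b ∷ t) s Fₑ)) ⟩
    (R₁ + R₂) + R₃           ≈⟨ +-assoc R₁ R₂ R₃ ⟩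
    R₁ + (R₂ + R₃)           ≈⟨ +-congʳ (Sh-∷ b t e s _) ⟩
    (Rᵦ + Rₑ) + (R₂ + R₃)   ≈⟨ interchange _ _ _ _ ⟩
    (Rᵦ + R₂) + (Rₑ + R₃)
      ≈⟨ +-cong (trans (sym (∑-+ (shuffleW t (e ∷ s)) _ _)) (∑-cong (shuffleW t (e ∷ s)) (λ y → sym (Sh-∷ a u b y F))))
                (trans (sym (∑-+ (shuffleW (b ∷ t) s) _ _)) (∑-cong (shuffleW (b ∷ t) s) (λ y → sym (Sh-∷ a u e y F)))) ⟩
    (∑[ y ← shuffleW t (e ∷ s) ] Sh (a ∷ u) (b ∷ y) F) + (∑[ y ← shuffleW (b ∷ t) s ] Sh (a ∷ u) (e ∷ y) F)
      ≈⟨ Sh-∷ b t e s _ ⟨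
    ∑[ y ← shuffleW (b ∷ t) (e ∷ s) ] Sh (a ∷ u) y F ∎
    where
    Fₐ Fᵦ Fₑ : Word → Carrier
    Fₐ x = F (a ∷ x)
    Fᵦ x = F (b ∷ x)
    Fₑ x = F (e ∷ x)
    L₁ L₂ Lₐ Lᵦ R₁ R₂ R₃ Rᵦ Rₑ : Carrier
    L₁ = ∑[ x ← shuffleW u (b ∷ t) ] Sh x (e ∷ s) Fₐ
    L₂ = ∑[ x ← shuffleW (a ∷ u) t ] Sh x (e ∷ s) Fᵦ
    Lₐ = ∑[ x ← shuffleW u (b ∷ t) ] Sh (a ∷ x) s Fₑ
    Lᵦ = ∑[ x ← shuffleW (a ∷ u) t ] Sh (b ∷ x) s Fₑ
    R₁ = ∑[ y ← shuffleW (b ∷ t) (e ∷ s) ] Sh u y Fₐ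
    R₂ = ∑[ y ← shuffleW t (e ∷ s) ] Sh (a ∷ u) y Fᵦ
    R₃ = ∑[ y ← shuffleW (b ∷ t) s ] Sh (a ∷ u) y Fₑ
    Rᵦ = ∑[ y ← shuffleW t (e ∷ s) ] Sh u (b ∷ y) Fₐ
    Rₑ = ∑[ y ← shuffleW (b ∷ t) s ] Sh u (e ∷ y) Fₐ

  ш-assoc : ∀ p q r → (p ш q) ш r ≋ p ш (q ш r)
  ш-assoc p q r = mk≋ λ F → begin
    eval ((p ш q) ш r) F
      ≈⟨ eval-ш (p ш q) r F ⟩
    eval (p ш q) (λ x → eval r (λ s → Sh x s F))
      ≈⟨ eval-ш p q _ ⟩
    eval p (λ u → eval q (λ t → Sh u t (λ x → eval r (λ s → Sh x s F))))
      ≈⟨ eval-cong p (λ u → eval-cong q (λ t → trans (sym (eval-∑ r (shuffleW u t) _))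
                           (eval-cong r (λ s → Sh-assoc u t s F)))) ⟩
    eval p (λ u → eval q (λ t → eval r (λ s → Sh t s (λ y → Sh u y F))))
      ≈⟨ eval-cong p (λ u → eval-ш q r _) ⟨
    eval p (λ u → eval (q ш r) (λ y → Sh u y F))
      ≈⟨ eval-ш p (q ш r) F ⟨
    eval (p ш (q ш r)) F ∎

  Sh-X^ : ∀ j b F → Sh (replicate j X) (replicate b X) F ≈ binom j b * F (replicate (j ℕ.+ b) X)
  Sh-X^ zero    b       F = trans (Sh-[]ˡ _ F) (sym (*-identityˡ _))
  Sh-X^ (suc j) zero    F =
    trans (Sh-[]ʳ _ F) (sym (trans (*-identityˡ _) (reflexive (≡.cong (λ n → F (replicate (suc n) X)) (ℕ.+-identityʳ j)))))
  Sh-X^ (suc j) (suc b) F = begin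
    Sh (replicate (suc j) X) (replicate (suc b) X) F
      ≈⟨ Sh-∷ X (replicate j X) X (replicate b X) F ⟩
    Sh (replicate j X) (replicate (suc b) X) Fₓ + Sh (replicate (suc j) X) (replicate b X) Fₓ
      ≈⟨ +-cong (Sh-X^ j (suc b) Fₓ) (Sh-X^ (suc j) b Fₓ) ⟩
    binom j (suc b) * Fₓ (replicate (j ℕ.+ suc b) X) + binom (suc j) b * Fₓ (replicate (suc j ℕ.+ b) X)
      ≈⟨ +-congˡ (*-congˡ (reflexive (≡.cong (λ n → Fₓ (replicate n X)) (≡.sym (ℕ.+-suc j b))))) ⟩
    binom j (suc b) * Fₓ (replicate (j ℕ.+ suc b) X) + binom (suc j) b * Fₓ (replicate (j ℕ.+ suc b) X)
      ≈⟨ distribʳ _ _ _ ⟨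
    binom (suc j) (suc b) * F (replicate (suc j ℕ.+ suc b) X) ∎
    where
    Fₓ : Word → Carrier
    Fₓ x = F (X ∷ x)

  X^-ш-X^ : ∀ j b → X^ j ш X^ b ≋ binom j b ·P X^ (j ℕ.+ b)
  X^-ш-X^ j b = mk≋ λ F → begin
    eval (X^ j ш X^ b) F                                        ≈⟨ eval-ш (X^ j) (X^ b) F ⟩
    eval (X^ j) (λ u → eval (X^ b) (λ t → Sh u t F))            ≈⟨ eval-X^ j (λ u → eval (X^ b) (λ t → Sh u t F)) ⟩
    eval (X^ b) (λ t → Sh (replicate j X) t F)                  ≈⟨ eval-X^ b (λ t → Sh (replicate j X) t F) ⟩
    Sh (replicate j X) (replicate b X) F                         ≈⟨ Sh-X^ j b F ⟩
    binom j b * F (replicate (j ℕ.+ b) X)                        ≈⟨ *-congˡ (eval-X^ (j ℕ.+ b) F) ⟨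
    binom j b * eval (X^ (j ℕ.+ b)) F                            ≈⟨ eval-·P (binom j b) (X^ (j ℕ.+ b)) F ⟨
    eval (binom j b ·P X^ (j ℕ.+ b)) F                           ∎

module RightDerivative {c ℓ} (R : CommutativeRing c ℓ) where
  open CommutativeRing R
  open Over R
  open ListSum semiring
  open Evaluation R
  open SetoidReasoning setoid
  open import Algebra.Properties.CommutativeSemigroup +-commutativeSemigroup using (interchange)

  ∂ : Letter → Poly → Poly
  ∂ c p = concatMap (λ (a , v) → map (a ,_) (quotientʳ c v)) p

  D : Letter → (Word → Carrier) → Word → Carrier
  D c F x = ∑ (quotientʳ c x) F

  eval-∂ : ∀ c p F → eval (∂ c p) F ≈ eval p (D c F)
  eval-∂ c p F = trans (∑-concatMap _ p _) (∑-cong p λ (a , v) →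
    trans (∑-map _ (quotientʳ c v) _) (∑-*ˡ (quotientʳ c v) a F))

  ∂-cong : ∀ c {p q} → p ≋ q → ∂ c p ≋ ∂ c q
  ∂-cong c {p} {q} e = mk≋ λ F → trans (eval-∂ c p F) (trans (eval-≋ e _) (sym (eval-∂ c q F)))

  D-∷ʳ : ∀ c F u → D c F (u ∷ʳ c) ≈ F u
  D-∷ʳ c F u rewrite quotientʳ-∷ʳ c u = +-identityʳ _

  D-∷ʳ-≢ : ∀ {c c′} F u → c′ ≢ c → D c F (u ∷ʳ c′) ≈ 0#
  D-∷ʳ-≢ F u c′≢c rewrite quotientʳ-∷ʳ-≢ u c′≢c = refl

  D-cong : ∀ c x {F G : Word → Carrier} → (∀ y → F y ≈ G y) → D c F x ≈ D c G x
  D-cong c x = ∑-cong (quotientʳ c x)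

  D-∷ : ∀ c a F {x} → x ≢ [] → D c F (a ∷ x) ≈ D c (λ y → F (a ∷ y)) x
  D-∷ c a F {[]}    x≢[] = ⊥-elim (x≢[] ≡.refl)
  D-∷ c a F {y ∷ x} _    = ∑-map (a ∷_) (quotientʳ c (y ∷ x)) F

  D-δ : ∀ c w u → D c (δ w) u ≈ δ (w ∷ʳ c) u
  D-δ c w u = go u (reverseView u)
    where
    go : ∀ u → Reverse u → D c (δ w) u ≈ δ (w ∷ʳ c) u
    go .[] [] = sym (δ-≢ (∷ʳ≢[] w ∘ ≡.sym))
    go .(v ∷ʳ c′) (v ∶ _ ∶ʳ c′) with c′ ≟L c
    ... | yes ≡.refl = trans (D-∷ʳ c (δ w) v) (by-cases (v ≟W w))
      where
      by-cases : _ → δ w v ≈ δ (w ∷ʳ c) (v ∷ʳ c)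
      by-cases (yes v≡w) = trans (δ-≡ v≡w) (sym (δ-≡ (≡.cong (_∷ʳ c) v≡w)))
      by-cases (no  v≢w) = trans (δ-≢ v≢w) (sym (δ-≢ (v≢w ∘ proj₁ ∘ List.∷ʳ-injective v w)))
    ... | no  c′≢c   = trans (D-∷ʳ-≢ (δ w) v c′≢c) (sym (δ-≢ (c′≢c ∘ proj₂ ∘ List.∷ʳ-injective v w)))

  coeff-∷ʳ : ∀ c p w → coeff p (w ∷ʳ c) ≈ coeff (∂ c p) w
  coeff-∷ʳ c p w = begin
    coeff p (w ∷ʳ c)         ≈⟨ coeff-eval p (w ∷ʳ c) ⟩
    eval p (δ (w ∷ʳ c))      ≈⟨ eval-cong p (D-δ c w) ⟨
    eval p (D c (δ w))       ≈⟨ eval-∂ c p (δ w) ⟨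
    eval (∂ c (p)) (δ w)     ≈⟨ coeff-eval (∂ c p) w ⟨
    coeff (∂ c p) w          ∎

  coeff-∷ʳ-≋ : ∀ c p {q} w → ∂ c p ≋ q → coeff p (w ∷ʳ c) ≈ coeff q w
  coeff-∷ʳ-≋ c p w e = trans (coeff-∷ʳ c p w) (≋⇒≈P e w)

  D-Shˡ-∷ : ∀ c a u b t F → D c (λ x → Sh x (b ∷ t) F) (a ∷ u)
            ≈ D c (λ x → Sh x (b ∷ t) (λ y → F (a ∷ y))) u + D c (λ x → Sh x t (λ y → F (b ∷ y))) (a ∷ u)
  D-Shˡ-∷ c a []      b t F with a ≟L c
  ... | yes _ = sym (+-identityˡ _)
  ... | no  _ = sym (+-identityˡ _)
  D-Shˡ-∷ c a (z ∷ u) b t F = begin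
    D c (λ x → Sh x (b ∷ t) F) (a ∷ z ∷ u)
      ≈⟨ ∑-map (a ∷_) (quotientʳ c (z ∷ u)) _ ⟩
    ∑[ x ← quotientʳ c (z ∷ u) ] Sh (a ∷ x) (b ∷ t) F
      ≈⟨ ∑-cong (quotientʳ c (z ∷ u)) (λ x → Sh-∷ a x b t F) ⟩
    ∑[ x ← quotientʳ c (z ∷ u) ] (Sh x (b ∷ t) Fₐ + Sh (a ∷ x) t Fᵦ)
      ≈⟨ ∑-+ (quotientʳ c (z ∷ u)) _ _ ⟩
    D c (λ x → Sh x (b ∷ t) Fₐ) (z ∷ u) + (∑[ x ← quotientʳ c (z ∷ u) ] Sh (a ∷ x) t Fᵦ)
      ≈⟨ +-congˡ (∑-map (a ∷_) (quotientʳ c (z ∷ u)) _) ⟨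
    D c (λ x → Sh x (b ∷ t) Fₐ) (z ∷ u) + D c (λ x → Sh x t Fᵦ) (a ∷ z ∷ u) ∎
    where
    Fₐ Fᵦ : Word → Carrier
    Fₐ y = F (a ∷ y)
    Fᵦ y = F (b ∷ y)

  D-Shʳ-∷ : ∀ c a u b t F → D c (λ y → Sh (a ∷ u) y F) (b ∷ t)
            ≈ D c (λ y → Sh u y (λ x → F (a ∷ x))) (b ∷ t) + D c (λ y → Sh (a ∷ u) y (λ x → F (b ∷ x))) t
  D-Shʳ-∷ c a u b []      F with b ≟L c
  ... | yes _ = sym (trans (+-identityʳ _) (+-congʳ (trans (Sh-[]ʳ u (λ x → F (a ∷ x))) (sym (Sh-[]ʳ (a ∷ u) F)))))
  ... | no  _ = sym (+-identityˡ _)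
  D-Shʳ-∷ c a u b (z ∷ t) F = begin
    D c (λ y → Sh (a ∷ u) y F) (b ∷ z ∷ t)
      ≈⟨ ∑-map (b ∷_) (quotientʳ c (z ∷ t)) _ ⟩
    ∑[ y ← quotientʳ c (z ∷ t) ] Sh (a ∷ u) (b ∷ y) F
      ≈⟨ ∑-cong (quotientʳ c (z ∷ t)) (λ y → Sh-∷ a u b y F) ⟩
    ∑[ y ← quotientʳ c (z ∷ t) ] (Sh u (b ∷ y) Fₐ + Sh (a ∷ u) y Fᵦ)
      ≈⟨ ∑-+ (quotientʳ c (z ∷ t)) _ _ ⟩
    (∑[ y ← quotientʳ c (z ∷ t) ] Sh u (b ∷ y) Fₐ) + D c (λ y → Sh (a ∷ u) y Fᵦ) (z ∷ t)
      ≈⟨ +-congʳ (∑-map (b ∷_) (quotientʳ c (z ∷ t)) _) ⟨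
    D c (λ y → Sh u y Fₐ) (b ∷ z ∷ t) + D c (λ y → Sh (a ∷ u) y Fᵦ) (z ∷ t) ∎
    where
    Fₐ Fᵦ : Word → Carrier
    Fₐ x = F (a ∷ x)
    Fᵦ x = F (b ∷ x)

  D-Sh : ∀ c u t F → Sh u t (D c F) ≈ D c (λ x → Sh x t F) u + D c (λ y → Sh u y F) t
  D-Sh c []      t       F = trans (Sh-[]ˡ t (D c F)) (sym (trans (+-identityˡ _) (D-cong c t (λ y → Sh-[]ˡ y F))))
  D-Sh c (a ∷ u) []      F = trans (Sh-[]ʳ (a ∷ u) (D c F))
    (sym (trans (+-identityʳ _) (D-cong c (a ∷ u) (λ x → Sh-[]ʳ x F))))
  D-Sh c (a ∷ u) (b ∷ t) F = begin
    Sh (a ∷ u) (b ∷ t) (D c F)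
      ≈⟨ Sh-∷ a u b t (D c F) ⟩
    Sh u (b ∷ t) (λ x → D c F (a ∷ x)) + Sh (a ∷ u) t (λ x → D c F (b ∷ x))
      ≈⟨ +-cong (∑-congᴬ (shuffleW u (b ∷ t)) (All.map (D-∷ c a F) (shuffleW-≢[]ʳ u b t)))
                (∑-congᴬ (shuffleW (a ∷ u) t) (All.map (D-∷ c b F) (shuffleW-≢[]ˡ a u t))) ⟩
    Sh u (b ∷ t) (D c Fₐ) + Sh (a ∷ u) t (D c Fᵦ)
      ≈⟨ +-cong (D-Sh c u (b ∷ t) Fₐ) (D-Sh c (a ∷ u) t Fᵦ) ⟩
    (D c (λ x → Sh x (b ∷ t) Fₐ) u + D c (λ y → Sh u y Fₐ) (b ∷ t))
      + (D c (λ x → Sh x t Fᵦ) (a ∷ u) + D c (λ y → Sh (a ∷ u) y Fᵦ) t)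
      ≈⟨ interchange _ _ _ _ ⟩
    (D c (λ x → Sh x (b ∷ t) Fₐ) u + D c (λ x → Sh x t Fᵦ) (a ∷ u))
      + (D c (λ y → Sh u y Fₐ) (b ∷ t) + D c (λ y → Sh (a ∷ u) y Fᵦ) t)
      ≈⟨ +-cong (D-Shˡ-∷ c a u b t F) (D-Shʳ-∷ c a u b t F) ⟨
    D c (λ x → Sh x (b ∷ t) F) (a ∷ u) + D c (λ y → Sh (a ∷ u) y F) (b ∷ t) ∎
    where
    Fₐ Fᵦ : Word → Carrier
    Fₐ x = F (a ∷ x)
    Fᵦ x = F (b ∷ x)

  ∂-ш : ∀ c p q → ∂ c (p ш q) ≋ (∂ c p ш q) +P (p ш ∂ c q)
  ∂-ш c p q = mk≋ λ F → begin
    eval (∂ c (p ш q)) F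
      ≈⟨ eval-∂ c (p ш q) F ⟩
    eval (p ш q) (D c F)
      ≈⟨ eval-ш p q (D c F) ⟩
    eval p (λ u → eval q (λ t → Sh u t (D c F)))
      ≈⟨ eval-cong p (λ u → trans (eval-cong q (λ t → D-Sh c u t F)) (eval-+ q _ _)) ⟩
    eval p (λ u → eval q (λ t → D c (λ u′ → Sh u′ t F) u) + eval q (D c (λ t′ → Sh u t′ F)))
      ≈⟨ eval-+ p _ _ ⟩
    eval p (λ u → eval q (λ t → D c (λ u′ → Sh u′ t F) u)) + eval p (λ u → eval q (D c (λ t′ → Sh u t′ F)))
      ≈⟨ +-cong (trans (eval-cong p (λ u → eval-∑ q (quotientʳ c u) (λ t u′ → Sh u′ t F)))
                       (trans (sym (eval-∂ c p _)) (sym (eval-ш (∂ c p) q F))))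
                (trans (eval-cong p (λ u → sym (eval-∂ c q _))) (sym (eval-ш p (∂ c q) F))) ⟩
    eval (∂ c p ш q) F + eval (p ш ∂ c q) F
      ≈⟨ eval-+P (∂ c p ш q) (p ш ∂ c q) F ⟨
    eval ((∂ c p ш q) +P (p ш ∂ c q)) F ∎

  ∂-*P-letter : ∀ c p → ∂ c (p *P letter c) ≋ p
  ∂-*P-letter c p = mk≋ λ F → begin
    eval (∂ c (p *P letter c)) F      ≈⟨ eval-∂ c (p *P letter c) F ⟩
    eval (p *P letter c) (D c F)      ≈⟨ eval-*P-letter p c (D c F) ⟩
    eval p (λ u → D c F (u ∷ʳ c))     ≈⟨ eval-cong p (D-∷ʳ c F) ⟩
    eval p F                          ∎

  ∂-*P-letter-≢ : ∀ {c c′} p → c′ ≢ c → ∂ c (p *P letter c′) ≋ 0P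
  ∂-*P-letter-≢ {c} {c′} p c′≢c = mk≋ λ F → begin
    eval (∂ c (p *P letter c′)) F     ≈⟨ eval-∂ c (p *P letter c′) F ⟩
    eval (p *P letter c′) (D c F)     ≈⟨ eval-*P-letter p c′ (D c F) ⟩
    eval p (λ u → D c F (u ∷ʳ c′))    ≈⟨ eval-zero p (λ u → D-∷ʳ-≢ F u c′≢c) ⟩
    0#                                ∎

  ∂X-X^ : ∀ n → ∂ X (X^ (suc n)) ≋ X^ n
  ∂X-X^ n = mk≋ λ F → begin
    eval (∂ X (X^ (suc n))) F           ≈⟨ eval-∂ X (X^ (suc n)) F ⟩
    eval (X^ (suc n)) (D X F)           ≈⟨ eval-X^ (suc n) (D X F) ⟩
    D X F (replicate (suc n) X)         ≡⟨ ≡.cong (D X F) (replicate-∷ʳ n X) ⟩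
    D X F (replicate n X ∷ʳ X)          ≈⟨ D-∷ʳ X F (replicate n X) ⟩
    F (replicate n X)                   ≈⟨ eval-X^ n F ⟨
    eval (X^ n) F                       ∎

  ∂Y-X^ : ∀ n → ∂ Y (X^ n) ≋ 0P
  ∂Y-X^ zero    = ≋-refl
  ∂Y-X^ (suc n) = mk≋ λ F → begin
    eval (∂ Y (X^ (suc n))) F           ≈⟨ eval-∂ Y (X^ (suc n)) F ⟩
    eval (X^ (suc n)) (D Y F)           ≈⟨ eval-X^ (suc n) (D Y F) ⟩
    D Y F (replicate (suc n) X)         ≡⟨ ≡.cong (D Y F) (replicate-∷ʳ n X) ⟩
    D Y F (replicate n X ∷ʳ X)          ≈⟨ D-∷ʳ-≢ F (replicate n X) (λ ()) ⟩
    0#                                  ∎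

  coeff-*P-letter-[] : ∀ p c → coeff (p *P letter c) [] ≈ 0#
  coeff-*P-letter-[] p c = trans (coeff-eval (p *P letter c) [])
    (trans (eval-*P-letter p c (δ [])) (eval-zero p (λ u → δ-≢ (∷ʳ≢[] u))))

  δ-∷ʳ : ∀ c v w → δ (v ∷ʳ c) (w ∷ʳ c) ≈ δ v w
  δ-∷ʳ c v w = trans (sym (D-δ c v (w ∷ʳ c))) (D-∷ʳ c (δ v) w)

  δ-∷ʳ-≢ : ∀ {c c′} v w → c′ ≢ c → δ (v ∷ʳ c′) (w ∷ʳ c) ≈ 0#
  δ-∷ʳ-≢ {c} {c′} v w c′≢c = trans (sym (D-δ c′ v (w ∷ʳ c))) (D-∷ʳ-≢ (δ v) w (c′≢c ∘ ≡.sym))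

module Homogeneity {c ℓ} (R : CommutativeRing c ℓ) where
  open CommutativeRing R
  open Over R
  open Evaluation R

  Homogeneous : ℕ → Poly → Set c
  Homogeneous n p = All (λ e → length (proj₂ e) ≡ n) p

  X^-homogeneous : ∀ n → Homogeneous n (X^ n)
  X^-homogeneous n = List.length-replicate n ∷ []

  ·P-homogeneous : ∀ a {n p} → Homogeneous n p → Homogeneous n (a ·P p)
  ·P-homogeneous a h = All.map⁺ h

  *P-homogeneous : ∀ {m n} p q → Homogeneous m p → Homogeneous n q → Homogeneous (m ℕ.+ n) (p *P q)
  *P-homogeneous p q hp hq = All.concat⁺ (All.map⁺ (All.map (λ {(a , v)} hv →
    All.map⁺ (All.map (λ {(b , w)} hw → ≡.trans (List.length-++ v) (≡.cong₂ ℕ._+_ hv hw)) hq)) hp))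

  ш-homogeneous : ∀ {m n} p q → Homogeneous m p → Homogeneous n q → Homogeneous (m ℕ.+ n) (p ш q)
  ш-homogeneous p q hp hq = All.concat⁺ (All.map⁺ (All.map (λ {(a , v)} hv →
    All.concat⁺ (All.map⁺ (All.map (λ {(b , w)} hw → All.map⁺ (All.map
      (λ e → ≡.trans e (≡.cong₂ ℕ._+_ hv hw)) (shuffleW-length v w))) hq))) hp))

  Y⁽⁾-homogeneous : ∀ j → Homogeneous (suc j) Y⁽ j ⁾
  Y⁽⁾-homogeneous zero    = ≡.refl ∷ []
  Y⁽⁾-homogeneous (suc j) = All.++⁺
    (*P-homogeneous Xp Y⁽ j ⁾ (≡.refl ∷ []) (Y⁽⁾-homogeneous j))
    (·P-homogeneous (- 1#) (≡.subst (λ n → Homogeneous n (Y⁽ j ⁾ *P Xp)) (ℕ.+-comm (suc j) 1)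
      (*P-homogeneous Y⁽ j ⁾ Xp (Y⁽⁾-homogeneous j) (≡.refl ∷ []))))

  coeff-homogeneous : ∀ {n p} w → Homogeneous n p → length w ≢ n → coeff p w ≈ 0#
  coeff-homogeneous {p = p} w h |w|≢n = trans (coeff-eval p w)
    (eval-zeroᴬ p (All.map (λ {e} |v|≡n → δ-≢ {w} {proj₂ e}
      (λ v≡w → |w|≢n (≡.trans (≡.cong length (≡.sym v≡w)) |v|≡n))) h))

  degree : Poly → ℕ
  degree []            = 0
  degree ((_ , w) ∷ p) = length w ℕ.⊔ degree p

  degree-bound : ∀ p → All (λ e → length (proj₂ e) ≤ degree p) p
  degree-bound []            = []
  degree-bound ((_ , w) ∷ p) =
    ℕ.m≤m⊔n (length w) (degree p) ∷ All.map (λ le → ℕ.≤-trans le (ℕ.m≤n⊔m (length w) (degree p))) (degree-bound p)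

  coeff-degree : ∀ p x → degree p < length x → coeff p x ≈ 0#
  coeff-degree p x deg<|x| = trans (coeff-eval p x) (eval-zeroᴬ p
    (All.map (λ {e} |v|≤deg → δ-≢ {x} {proj₂ e}
      (λ v≡x → ℕ.<-irrefl (≡.cong length v≡x) (ℕ.≤-<-trans |v|≤deg deg<|x|))) (degree-bound p)))

  pairing-homogeneous : ∀ {n} p u → Homogeneous n p → degree u < n → ⟨ p , u ⟩ ≈ 0#
  pairing-homogeneous p u h deg<n = trans (pairing-eval p u)
    (eval-zeroᴬ p (All.map (λ {e} |v|≡n → coeff-degree u (proj₂ e) (≡.subst (degree u <_) (≡.sym |v|≡n) deg<n)) h))

module Expansion {c ℓ} (R : CommutativeRing c ℓ) where
  open CommutativeRing R
  open Over R
  open ListSum semiring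
  open Binomial semiring
  open Evaluation R
  open RightDerivative R
  open Homogeneity R
  module ≈-Reasoning = SetoidReasoning setoid
  open import Algebra.Properties.Ring ring using (-1*x≈-x)

  Yprod : List ℕ → Poly
  Yprod ks = foldr (λ k p → Y⁽ k ⁾ *P p) 1P ks

  Yprod-∷ʳ : ∀ ks j → Yprod (ks ∷ʳ j) ≋ Yprod ks *P Y⁽ j ⁾
  Yprod-∷ʳ []       j = ≋-trans (*P-identityʳ Y⁽ j ⁾) (≋-sym (*P-identityˡ Y⁽ j ⁾))
  Yprod-∷ʳ (k ∷ ks) j = ≋-trans (*P-congʳ Y⁽ k ⁾ (Yprod-∷ʳ ks j)) (≋-sym (*P-assoc Y⁽ k ⁾ (Yprod ks) Y⁽ j ⁾))

  M-∷ʳ : ∀ ks j b → M (ks ∷ʳ j , b) ≋ Yprod ks *P (Y⁽ j ⁾ *P X^ b)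
  M-∷ʳ ks j b = ≋-trans (*P-congˡ (X^ b) (Yprod-∷ʳ ks j)) (*P-assoc (Yprod ks) Y⁽ j ⁾ (X^ b))

  X^-*P-X : ∀ n → X^ n *P Xp ≋ X^ (suc n)
  X^-*P-X n = mk≋ λ F → begin
    eval (X^ n *P Xp) F           ≈⟨ eval-*P-letter (X^ n) X F ⟩
    eval (X^ n) (λ u → F (u ∷ʳ X)) ≈⟨ eval-X^ n (λ u → F (u ∷ʳ X)) ⟩
    F (replicate n X ∷ʳ X)        ≡⟨ ≡.cong F (replicate-∷ʳ n X) ⟨
    F (replicate (suc n) X)       ≈⟨ eval-X^ (suc n) F ⟨
    eval (X^ (suc n)) F           ∎
    where open ≈-Reasoning

  M-*P-X : ∀ ks b → M (ks , b) *P Xp ≋ M (ks , suc b)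
  M-*P-X ks b = ≋-trans (*P-assoc (Yprod ks) (X^ b) Xp) (*P-congʳ (Yprod ks) (X^-*P-X b))

  X-*P-Y⁽⁾ : ∀ j → Xp *P Y⁽ j ⁾ ≋ Y⁽ suc j ⁾ +P (Y⁽ j ⁾ *P Xp)
  X-*P-Y⁽⁾ j = mk≋ λ F → sym (begin
    eval (Y⁽ suc j ⁾ +P (Y⁽ j ⁾ *P Xp)) F             ≈⟨ eval-+P Y⁽ suc j ⁾ (Y⁽ j ⁾ *P Xp) F ⟩
    eval Y⁽ suc j ⁾ F + eval (Y⁽ j ⁾ *P Xp) F         ≈⟨ +-congʳ (eval-+P (Xp *P Y⁽ j ⁾) (-P (Y⁽ j ⁾ *P Xp)) F) ⟩
    (eval (Xp *P Y⁽ j ⁾) F + eval (-P (Y⁽ j ⁾ *P Xp)) F) + eval (Y⁽ j ⁾ *P Xp) F ≈⟨ +-assoc _ _ _ ⟩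
    eval (Xp *P Y⁽ j ⁾) F + (eval (-P (Y⁽ j ⁾ *P Xp)) F + eval (Y⁽ j ⁾ *P Xp) F)
      ≈⟨ +-congˡ (trans (+-congʳ (trans (eval-·P (- 1#) (Y⁽ j ⁾ *P Xp) F) (-1*x≈-x _))) (-‿inverseˡ _)) ⟩
    eval (Xp *P Y⁽ j ⁾) F + 0#                        ≈⟨ +-identityʳ _ ⟩
    eval (Xp *P Y⁽ j ⁾) F                             ∎)
    where open ≈-Reasoning

  X-*P-Y⁽⁾X^ : ∀ j b → Xp *P (Y⁽ j ⁾ *P X^ b) ≋ (Y⁽ suc j ⁾ *P X^ b) +P (Y⁽ j ⁾ *P X^ (suc b))
  X-*P-Y⁽⁾X^ j b = begin
    Xp *P (Y⁽ j ⁾ *P X^ b)                              ≈⟨ *P-assoc Xp Y⁽ j ⁾ (X^ b) ⟨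
    (Xp *P Y⁽ j ⁾) *P X^ b                              ≈⟨ *P-congˡ (X^ b) (X-*P-Y⁽⁾ j) ⟩
    (Y⁽ suc j ⁾ +P (Y⁽ j ⁾ *P Xp)) *P X^ b              ≈⟨ *P-distribʳ Y⁽ suc j ⁾ (Y⁽ j ⁾ *P Xp) (X^ b) ⟩
    (Y⁽ suc j ⁾ *P X^ b) +P ((Y⁽ j ⁾ *P Xp) *P X^ b)    ≈⟨ +P-cong ≋-refl (*P-assoc Y⁽ j ⁾ Xp (X^ b)) ⟩
    (Y⁽ suc j ⁾ *P X^ b) +P (Y⁽ j ⁾ *P (Xp *P X^ b))    ≈⟨ +P-cong ≋-refl (*P-congʳ Y⁽ j ⁾ X-*P-X^) ⟩
    (Y⁽ suc j ⁾ *P X^ b) +P (Y⁽ j ⁾ *P X^ (suc b))      ∎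
    where
    open ≋-Reasoning
    X-*P-X^ : Xp *P X^ b ≋ X^ (suc b)
    X-*P-X^ = mk≋ λ F → trans (eval-letter-*P X (X^ b) F) (trans (eval-X^ b (λ t → F (X ∷ t))) (sym (eval-X^ (suc b) F)))

  eval-X^-*P : ∀ n p F → eval (X^ n *P p) F ≈ eval p (λ t → F (replicate n X ++ t))
  eval-X^-*P n p F = trans (eval-*P (X^ n) p F) (eval-X^ n (λ u → eval p (λ t → F (u ++ t))))

  X^-*P-Y : ∀ a F → eval (X^ a *P Yp) F ≈ ∑ᵈ a (λ j b → binom j b * eval (Y⁽ j ⁾ *P X^ b) F)
  X^-*P-Y zero    F = begin
    eval (X^ 0 *P Yp) F                 ≈⟨ eval-≋ (*P-identityˡ Yp) F ⟩
    eval Yp F                           ≈⟨ eval-≋ (*P-identityʳ Yp) F ⟨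
    eval (Yp *P X^ 0) F                 ≈⟨ *-identityˡ _ ⟨
    1# * eval (Yp *P X^ 0) F            ≈⟨ +-identityʳ _ ⟨
    ∑ᵈ 0 (λ j b → binom j b * eval (Y⁽ j ⁾ *P X^ b) F) ∎
    where open ≈-Reasoning
  X^-*P-Y (suc a) F = begin
    eval (X^ (suc a) *P Yp) F
      ≈⟨ trans (eval-X^-*P (suc a) Yp F) (sym (eval-X^-*P a Yp (λ u → F (X ∷ u)))) ⟩
    eval (X^ a *P Yp) (λ u → F (X ∷ u))
      ≈⟨ X^-*P-Y a _ ⟩
    ∑ᵈ a (λ j b → binom j b * eval (Y⁽ j ⁾ *P X^ b) (λ u → F (X ∷ u)))
      ≈⟨ ∑-cong (antidiagonal a) (λ (j , b) → *-congˡ (trans (sym (eval-letter-*P X (Y⁽ j ⁾ *P X^ b) F))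
           (trans (eval-≋ (X-*P-Y⁽⁾X^ j b) F) (eval-+P (Y⁽ suc j ⁾ *P X^ b) (Y⁽ j ⁾ *P X^ (suc b)) F)))) ⟩
    ∑ᵈ a (λ j b → binom j b * (eval (Y⁽ suc j ⁾ *P X^ b) F + eval (Y⁽ j ⁾ *P X^ (suc b)) F))
      ≈⟨ pascal a (λ j b → eval (Y⁽ j ⁾ *P X^ b) F) ⟨
    ∑ᵈ (suc a) (λ j b → binom j b * eval (Y⁽ j ⁾ *P X^ b) F) ∎
    where open ≈-Reasoning

  M-*P-Y : ∀ ks a F → eval (M (ks , a) *P Yp) F ≈ ∑ᵈ a (λ j b → binom j b * eval (M (ks ∷ʳ j , b)) F)
  M-*P-Y ks a F = begin
    eval (M (ks , a) *P Yp) F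
      ≈⟨ eval-≋ (*P-assoc (Yprod ks) (X^ a) Yp) F ⟩
    eval (Yprod ks *P (X^ a *P Yp)) F
      ≈⟨ eval-*P (Yprod ks) (X^ a *P Yp) F ⟩
    eval (Yprod ks) (λ u → eval (X^ a *P Yp) (λ t → F (u ++ t)))
      ≈⟨ eval-cong (Yprod ks) (λ u → X^-*P-Y a _) ⟩
    eval (Yprod ks) (λ u → ∑ᵈ a (λ j b → binom j b * eval (Y⁽ j ⁾ *P X^ b) (λ t → F (u ++ t))))
      ≈⟨ eval-∑ (Yprod ks) (antidiagonal a) _ ⟩
    ∑ᵈ a (λ j b → eval (Yprod ks) (λ u → binom j b * eval (Y⁽ j ⁾ *P X^ b) (λ t → F (u ++ t))))
      ≈⟨ ∑-cong (antidiagonal a) (λ (j , b) → trans (eval-*ˡ (Yprod ks) (binom j b) _) (*-congˡ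
           (trans (sym (eval-*P (Yprod ks) (Y⁽ j ⁾ *P X^ b) F)) (sym (eval-≋ (M-∷ʳ ks j b) F))))) ⟩
    ∑ᵈ a (λ j b → binom j b * eval (M (ks ∷ʳ j , b)) F) ∎
    where open ≈-Reasoning

  -- P_d, together with P_0 = 1, so that S (ks , b) = P_d ш X^ b for every d.
  Pprod : List ℕ → Poly
  Pprod []       = 1P
  Pprod (k ∷ ks) = Pstep (X^ k *P Yp) ks

  S-Pprod : ∀ ks b → S (ks , b) ≋ Pprod ks ш X^ b
  S-Pprod []       b = ≋-sym (ш-identityˡ (X^ b))
  S-Pprod (k ∷ ks) b = ≋-refl

  Pstep-∷ʳ : ∀ p ks j → Pstep p (ks ∷ʳ j) ≡ (Pstep p ks ш X^ j) *P Yp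
  Pstep-∷ʳ p []       j = ≡.refl
  Pstep-∷ʳ p (k ∷ ks) j = Pstep-∷ʳ ((p ш X^ k) *P Yp) ks j

  Pprod-∷ʳ : ∀ ks j → Pprod (ks ∷ʳ j) ≋ (Pprod ks ш X^ j) *P Yp
  Pprod-∷ʳ []       j = *P-congˡ Yp (≋-sym (ш-identityˡ (X^ j)))
  Pprod-∷ʳ (k ∷ ks) j rewrite Pstep-∷ʳ (X^ k *P Yp) ks j = ≋-refl

  ∂X-Pprod : ∀ ks → ∂ X (Pprod ks) ≋ 0P
  ∂X-Pprod []       = ≋-refl
  ∂X-Pprod (k ∷ ks) = ∂X-Pstep (X^ k) ks
    where
    ∂X-Pstep : ∀ p ks → ∂ X (Pstep (p *P Yp) ks) ≋ 0P
    ∂X-Pstep p []       = ∂-*P-letter-≢ p (λ ())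
    ∂X-Pstep p (k ∷ ks) = ∂X-Pstep ((p *P Yp) ш X^ k) ks

  ∂X-S-suc : ∀ ks b → ∂ X (S (ks , suc b)) ≋ S (ks , b)
  ∂X-S-suc ks b = begin
    ∂ X (S (ks , suc b))                                           ≈⟨ ∂-cong X (S-Pprod ks (suc b)) ⟩
    ∂ X (Pprod ks ш X^ (suc b))                                    ≈⟨ ∂-ш X (Pprod ks) (X^ (suc b)) ⟩
    (∂ X (Pprod ks) ш X^ (suc b)) +P (Pprod ks ш ∂ X (X^ (suc b)))
      ≈⟨ +P-cong (ш-congˡ (X^ (suc b)) (∂X-Pprod ks)) (ш-congʳ (Pprod ks) (∂X-X^ b)) ⟩
    Pprod ks ш X^ b                                                ≈⟨ S-Pprod ks b ⟨
    S (ks , b)                                                     ∎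
    where open ≋-Reasoning

  ∂X-S-zero : ∀ ks → ∂ X (S (ks , 0)) ≋ 0P
  ∂X-S-zero ks = begin
    ∂ X (S (ks , 0))                                     ≈⟨ ∂-cong X (S-Pprod ks 0) ⟩
    ∂ X (Pprod ks ш X^ 0)                                ≈⟨ ∂-ш X (Pprod ks) (X^ 0) ⟩
    (∂ X (Pprod ks) ш X^ 0) +P (Pprod ks ш ∂ X (X^ 0))   ≈⟨ +P-cong (ш-congˡ (X^ 0) (∂X-Pprod ks)) (ш-zeroʳ (Pprod ks)) ⟩
    0P                                                   ∎
    where open ≋-Reasoning

  ∂Y-S-[] : ∀ b → ∂ Y (S ([] , b)) ≋ 0P
  ∂Y-S-[] = ∂Y-X^

  ∂Y-S-∷ʳ : ∀ ks j b → ∂ Y (S (ks ∷ʳ j , b)) ≋ binom j b ·P S (ks , j ℕ.+ b)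
  ∂Y-S-∷ʳ ks j b = begin
    ∂ Y (S (ks ∷ʳ j , b))                                            ≈⟨ ∂-cong Y (S-Pprod (ks ∷ʳ j) b) ⟩
    ∂ Y (Pprod (ks ∷ʳ j) ш X^ b)                                     ≈⟨ ∂-ш Y (Pprod (ks ∷ʳ j)) (X^ b) ⟩
    (∂ Y (Pprod (ks ∷ʳ j)) ш X^ b) +P (Pprod (ks ∷ʳ j) ш ∂ Y (X^ b))
      ≈⟨ +P-cong (ш-congˡ (X^ b) (≋-trans (∂-cong Y (Pprod-∷ʳ ks j)) (∂-*P-letter Y (Pprod ks ш X^ j))))
                 (≋-trans (ш-congʳ (Pprod (ks ∷ʳ j)) (∂Y-X^ b)) (ш-zeroʳ (Pprod (ks ∷ʳ j)))) ⟩
    ((Pprod ks ш X^ j) ш X^ b) +P 0P                                 ≈⟨ +P-identityʳ _ ⟩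
    (Pprod ks ш X^ j) ш X^ b                                         ≈⟨ ш-assoc (Pprod ks) (X^ j) (X^ b) ⟩
    Pprod ks ш (X^ j ш X^ b)                                         ≈⟨ ш-congʳ (Pprod ks) (X^-ш-X^ j b) ⟩
    Pprod ks ш (binom j b ·P X^ (j ℕ.+ b))                           ≈⟨ ш-·Pʳ (Pprod ks) (binom j b) (X^ (j ℕ.+ b)) ⟩
    binom j b ·P (Pprod ks ш X^ (j ℕ.+ b))                           ≈⟨ ·P-cong (binom j b) (S-Pprod ks (j ℕ.+ b)) ⟨
    binom j b ·P S (ks , j ℕ.+ b)                                    ∎
    where open ≋-Reasoning

  ∑-coeff-*P-letter : ∀ {a} {A : Set a} (L : List A) (s : A → Carrier) (m : A → Poly) c w →
                      (∀ v → ∑[ k ← L ] s k * coeff (m k) v ≈ δ v w) →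
                      ∀ v → ∑[ k ← L ] s k * coeff (m k *P letter c) v ≈ δ v (w ∷ʳ c)
  ∑-coeff-*P-letter L s m c w hyp v = go v (reverseView v)
    where
    go : ∀ v → Reverse v → ∑[ k ← L ] s k * coeff (m k *P letter c) v ≈ δ v (w ∷ʳ c)
    go .[] [] = trans (∑-zero L (λ k → trans (*-congˡ (coeff-*P-letter-[] (m k) c)) (zeroʳ _)))
                      (sym (δ-≢ (∷ʳ≢[] w)))
    go .(v ∷ʳ c′) (v ∶ _ ∶ʳ c′) with c ≟L c′
    ... | yes ≡.refl = trans (∑-cong L (λ k → *-congˡ (coeff-∷ʳ-≋ c (m k *P letter c) v (∂-*P-letter c (m k)))))
                             (trans (hyp v) (sym (δ-∷ʳ c v w)))
    ... | no  c≢c′   = trans (∑-zero L (λ k →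
                               trans (*-congˡ (coeff-∷ʳ-≋ c′ (m k *P letter c) v (∂-*P-letter-≢ (m k) c≢c′))) (zeroʳ _)))
                             (sym (δ-∷ʳ-≢ v w (c≢c′ ∘ ≡.sym)))

  ∑-indices-suc : ∀ n Φ → ∑ (indices (suc n)) Φ
                  ≈ Φ ([] , suc n) + (∑[ k ← indices n ] ∑ᵈ (proj₂ k) (λ j b → Φ (proj₁ k ∷ʳ j , b)))
  ∑-indices-suc n Φ = +-congˡ (trans (∑-concatMap children (indices n) Φ)
    (∑-cong (indices n) (λ k → ∑-map _ (antidiagonal (proj₂ k)) Φ)))

  ∑-indices-sucʳ : ∀ n Φ → (∀ ks → Φ (ks , 0) ≈ 0#) →
                   ∑ (indices (suc n)) Φ ≈ ∑[ k ← indices n ] Φ (proj₁ k , suc (proj₂ k))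
  ∑-indices-sucʳ zero    Φ Φ₀ = trans (∑-indices-suc 0 Φ) (+-congˡ (trans (+-congʳ (+-congʳ (Φ₀ ([] ∷ʳ 0))))
    (trans (+-identityʳ _) (+-identityˡ _))))
  ∑-indices-sucʳ (suc n) Φ Φ₀ = begin
    ∑ (indices (suc (suc n))) Φ
      ≈⟨ ∑-indices-suc (suc n) Φ ⟩
    Φ ([] , suc (suc n)) + ∑ (indices (suc n)) Ψ
      ≈⟨ +-congˡ (∑-indices-sucʳ n Ψ (λ ks → trans (+-identityʳ _) (Φ₀ (ks ∷ʳ 0)))) ⟩
    Φ ([] , suc (suc n)) + (∑[ k ← indices n ] Ψ (proj₁ k , suc (proj₂ k)))
      ≈⟨ +-congˡ (∑-cong (indices n) λ (ks , a) →
           trans (∑ᵈ-sucʳ a (λ j b → Φ (ks ∷ʳ j , b))) (trans (+-congˡ (Φ₀ (ks ∷ʳ suc a))) (+-identityʳ _))) ⟩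
    Φ ([] , suc (suc n)) + (∑[ k ← indices n ] ∑ᵈ (proj₂ k) (λ j b → Φ (proj₁ k ∷ʳ j , suc b)))
      ≈⟨ ∑-indices-suc n (λ (ks , b) → Φ (ks , suc b)) ⟨
    ∑[ k ← indices (suc n) ] Φ (proj₁ k , suc (proj₂ k)) ∎
    where
    open ≈-Reasoning
    Ψ : Index → Carrier
    Ψ (ks , a) = ∑ᵈ a (λ j b → Φ (ks ∷ʳ j , b))

  length-∷ʳ : ∀ (w : Word) c → length (w ∷ʳ c) ≡ suc (length w)
  length-∷ʳ w c = ≡.trans (List.length-++ w) (ℕ.+-comm (length w) 1)

  coeff-M-*P-Y : ∀ ks a v → coeff (M (ks , a) *P Yp) v ≈ ∑ᵈ a (λ j b → binom j b * coeff (M (ks ∷ʳ j , b)) v)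
  coeff-M-*P-Y ks a v = trans (coeff-eval (M (ks , a) *P Yp) v) (trans (M-*P-Y ks a (δ v))
    (∑-cong (antidiagonal a) (λ (j , b) → *-congˡ (sym (coeff-eval (M (ks ∷ʳ j , b)) v)))))

  ∑ᵈ-S-M-∷ʳ-Y : ∀ w v ks a →
    ∑ᵈ a (λ j b → coeff (S (ks ∷ʳ j , b)) (w ∷ʳ Y) * coeff (M (ks ∷ʳ j , b)) v)
    ≈ coeff (S (ks , a)) w * coeff (M (ks , a) *P Yp) v
  ∑ᵈ-S-M-∷ʳ-Y w v ks a = begin
    ∑ᵈ a (λ j b → coeff (S (ks ∷ʳ j , b)) (w ∷ʳ Y) * coeff (M (ks ∷ʳ j , b)) v)
      ≈⟨ ∑ᵈ-congᵈ a (λ j b j+b≡a → *-congʳ (begin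
           coeff (S (ks ∷ʳ j , b)) (w ∷ʳ Y)          ≈⟨ coeff-∷ʳ-≋ Y (S (ks ∷ʳ j , b)) w (∂Y-S-∷ʳ ks j b) ⟩
           coeff (binom j b ·P S (ks , j ℕ.+ b)) w    ≈⟨ coeff-·P (binom j b) (S (ks , j ℕ.+ b)) w ⟩
           binom j b * coeff (S (ks , j ℕ.+ b)) w     ≡⟨ ≡.cong (λ n → binom j b * coeff (S (ks , n)) w) j+b≡a ⟩
           binom j b * coeff (S (ks , a)) w           ≈⟨ *-comm _ _ ⟩
           coeff (S (ks , a)) w * binom j b           ∎)) ⟩
    ∑ᵈ a (λ j b → coeff (S (ks , a)) w * binom j b * coeff (M (ks ∷ʳ j , b)) v)
      ≈⟨ ∑-cong (antidiagonal a) (λ _ → *-assoc _ _ _) ⟩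
    ∑ᵈ a (λ j b → coeff (S (ks , a)) w * (binom j b * coeff (M (ks ∷ʳ j , b)) v))
      ≈⟨ ∑-*ˡ (antidiagonal a) _ _ ⟩
    coeff (S (ks , a)) w * ∑ᵈ a (λ j b → binom j b * coeff (M (ks ∷ʳ j , b)) v)
      ≈⟨ *-congˡ (coeff-M-*P-Y ks a v) ⟨
    coeff (S (ks , a)) w * coeff (M (ks , a) *P Yp) v ∎
    where open ≈-Reasoning

  ∑-S-M-∷ʳ : ∀ c w v → ∑[ k ← indices (suc (length w)) ] coeff (S k) (w ∷ʳ c) * coeff (M k) v
                     ≈ ∑[ k ← indices (length w) ] coeff (S k) w * coeff (M k *P letter c) v
  ∑-S-M-∷ʳ X w v = begin
    ∑[ k ← indices (suc (length w)) ] coeff (S k) (w ∷ʳ X) * coeff (M k) v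
      ≈⟨ ∑-indices-sucʳ (length w) _ (λ ks → trans (*-congʳ (coeff-∷ʳ-≋ X (S (ks , 0)) w (∂X-S-zero ks))) (zeroˡ _)) ⟩
    ∑[ k ← indices (length w) ] coeff (S (proj₁ k , suc (proj₂ k))) (w ∷ʳ X) * coeff (M (proj₁ k , suc (proj₂ k))) v
      ≈⟨ ∑-cong (indices (length w)) (λ (ks , b) →
           *-cong (coeff-∷ʳ-≋ X (S (ks , suc b)) w (∂X-S-suc ks b)) (≋⇒≈P (≋-sym (M-*P-X ks b)) v)) ⟩
    ∑[ k ← indices (length w) ] coeff (S k) w * coeff (M k *P Xp) v ∎
    where open ≈-Reasoning
  ∑-S-M-∷ʳ Y w v = begin
    ∑[ k ← indices (suc (length w)) ] coeff (S k) (w ∷ʳ Y) * coeff (M k) v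
      ≈⟨ ∑-indices-suc (length w) _ ⟩
    coeff (S ([] , suc (length w))) (w ∷ʳ Y) * coeff (M ([] , suc (length w))) v
      + (∑[ k ← indices (length w) ]
           ∑ᵈ (proj₂ k) (λ j b → coeff (S (proj₁ k ∷ʳ j , b)) (w ∷ʳ Y) * coeff (M (proj₁ k ∷ʳ j , b)) v))
      ≈⟨ +-cong (trans (*-congʳ (coeff-∷ʳ-≋ Y (S ([] , suc (length w))) w (∂Y-S-[] (suc (length w))))) (zeroˡ _))
                (∑-cong (indices (length w)) (λ (ks , a) → ∑ᵈ-S-M-∷ʳ-Y w v ks a)) ⟩
    0# + (∑[ k ← indices (length w) ] coeff (S k) w * coeff (M k *P Yp) v)
      ≈⟨ +-identityˡ _ ⟩
    ∑[ k ← indices (length w) ] coeff (S k) w * coeff (M k *P Yp) v ∎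
    where open ≈-Reasoning

  resolution : ∀ w v → ∑[ k ← indices (length w) ] coeff (S k) w * coeff (M k) v ≈ δ v w
  resolution w = go w (reverseView w)
    where
    go : ∀ w → Reverse w → ∀ v → ∑[ k ← indices (length w) ] coeff (S k) w * coeff (M k) v ≈ δ v w
    go .[] [] v = begin
      coeff (X^ 0) [] * coeff (M ([] , 0)) v + 0#  ≈⟨ +-identityʳ _ ⟩
      coeff (X^ 0) [] * coeff (M ([] , 0)) v       ≈⟨ *-cong (coeff-eval (X^ 0) []) (coeff-eval (M ([] , 0)) v) ⟩
      eval (X^ 0) (δ []) * eval (M ([] , 0)) (δ v) ≈⟨ *-cong (trans (eval-1P (δ [])) (δ-≡ {[]} ≡.refl))
                                                              (trans (eval-≋ (*P-identityʳ 1P) (δ v)) (eval-1P (δ v))) ⟩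
      1# * δ v []                                  ≈⟨ *-identityˡ _ ⟩
      δ v []                                       ∎
      where open ≈-Reasoning
    go .(w ∷ʳ c) (w ∶ w! ∶ʳ c) v rewrite length-∷ʳ w c =
      trans (∑-S-M-∷ʳ c w v) (∑-coeff-*P-letter (indices (length w)) (λ k → coeff (S k) w) M c w (go w w!) v)

  Yprod-homogeneous : ∀ ks → Homogeneous (weightᴸ ks) (Yprod ks)
  Yprod-homogeneous []       = ≡.refl ∷ []
  Yprod-homogeneous (k ∷ ks) = *P-homogeneous Y⁽ k ⁾ (Yprod ks) (Y⁽⁾-homogeneous k) (Yprod-homogeneous ks)

  M-homogeneous : ∀ k → Homogeneous (weight k) (M k)
  M-homogeneous (ks , b) = *P-homogeneous (Yprod ks) (X^ b) (Yprod-homogeneous ks) (X^-homogeneous b)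

  Pstep-homogeneous : ∀ {m} p ks → Homogeneous m p → Homogeneous (m ℕ.+ weightᴸ ks) (Pstep p ks)
  Pstep-homogeneous {m} p []       h = ≡.subst (λ n → Homogeneous n p) (≡.sym (ℕ.+-identityʳ m)) h
  Pstep-homogeneous {m} p (k ∷ ks) h = ≡.subst (λ n → Homogeneous n (Pstep ((p ш X^ k) *P Yp) ks))
    (≡.trans (ℕ.+-assoc (m ℕ.+ k) 1 (weightᴸ ks))
      (≡.trans (ℕ.+-assoc m k (suc (weightᴸ ks))) (≡.cong (m ℕ.+_) (ℕ.+-suc k (weightᴸ ks)))))
    (Pstep-homogeneous ((p ш X^ k) *P Yp) ks
      (*P-homogeneous (p ш X^ k) Yp (ш-homogeneous p (X^ k) h (X^-homogeneous k)) (≡.refl ∷ [])))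

  Pprod-homogeneous : ∀ ks → Homogeneous (weightᴸ ks) (Pprod ks)
  Pprod-homogeneous []       = ≡.refl ∷ []
  Pprod-homogeneous (k ∷ ks) = ≡.subst (λ n → Homogeneous n (Pprod (k ∷ ks)))
    (≡.trans (ℕ.+-assoc k 1 (weightᴸ ks)) (ℕ.+-suc k (weightᴸ ks)))
    (Pstep-homogeneous (X^ k *P Yp) ks (*P-homogeneous (X^ k) Yp (X^-homogeneous k) (≡.refl ∷ [])))

  S-homogeneous : ∀ k → Homogeneous (weight k) (S k)
  S-homogeneous ([] , b)     = X^-homogeneous b
  S-homogeneous (k ∷ ks , b) = ш-homogeneous (Pprod (k ∷ ks)) (X^ b) (Pprod-homogeneous (k ∷ ks)) (X^-homogeneous b)

  ∑-indices≤ : ∀ N m (g : Index → Carrier) → m ≤ N → (∀ k → weight k ≢ m → g k ≈ 0#) →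
               ∑ (indices≤ N) g ≈ ∑ (indices m) g
  ∑-indices≤ zero    m g m≤0   g₀ rewrite ℕ.n≤0⇒n≡0 m≤0 = refl
  ∑-indices≤ (suc N) m g m≤1+N g₀ with m ℕ.≟ suc N
  ... | yes ≡.refl = trans (∑-++ (indices (suc N)) (indices≤ N) g) (trans (+-congˡ (∑-zeroᴬ (indices≤ N)
        (All.map (λ {k} w≤N → g₀ k (λ w≡1+N → ℕ.<-irrefl w≡1+N (ℕ.s≤s w≤N))) (indices≤-weight N))))
        (+-identityʳ _))
  ... | no  m≢1+N  = trans (∑-++ (indices (suc N)) (indices≤ N) g) (trans (+-congʳ (∑-zeroᴬ (indices (suc N))
        (All.map (λ {k} w≡1+N → g₀ k (λ w≡m → m≢1+N (≡.trans (≡.sym w≡m) w≡1+N))) (indices-weight (suc N)))))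
        (trans (+-identityˡ _) (∑-indices≤ N m g (ℕ.≤-pred (ℕ.≤∧≢⇒< m≤1+N m≢1+N)) g₀)))

  resolution≤ : ∀ N w v → length w ≤ N → ∑[ k ← indices≤ N ] coeff (S k) w * coeff (M k) v ≈ δ v w
  resolution≤ N w v |w|≤N = trans
    (∑-indices≤ N (length w) _ |w|≤N
      (λ k w≢ → trans (*-congʳ (coeff-homogeneous w (S-homogeneous k) (w≢ ∘ ≡.sym))) (zeroˡ _)))
    (resolution w v)

  resolution≤ᵀ : ∀ N w v → length w ≤ N → ∑[ k ← indices≤ N ] coeff (M k) w * coeff (S k) v ≈ δ v w
  resolution≤ᵀ N w v |w|≤N with length v ℕ.≤? N
  ... | yes |v|≤N = trans (∑-cong (indices≤ N) (λ k → *-comm _ _)) (trans (resolution≤ N v w |v|≤N) (δ-comm w v))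
  ... | no  |v|≰N = trans (∑-zeroᴬ (indices≤ N) (All.map (λ {k} wt≤N → trans (*-congˡ
          (coeff-homogeneous v (S-homogeneous k) (λ |v|≡wt → |v|≰N (≡.subst (_≤ N) (≡.sym |v|≡wt) wt≤N)))) (zeroʳ _))
          (indices≤-weight N)))
        (sym (δ-≢ {v} {w} (λ w≡v → |v|≰N (≡.subst (_≤ N) (≡.cong length w≡v) |w|≤N))))

  finite-expansion : (A B : Index → Poly) → (∀ k → Homogeneous (weight k) (A k)) →
    (∀ N w v → length w ≤ N → ∑[ k ← indices≤ N ] coeff (A k) w * coeff (B k) v ≈ δ v w) →
    ∀ u → FinSumRep u (λ k → ⟨ A k , u ⟩ ·P B k)
  finite-expansion A B A-homogeneous A-resolution u = indices≤ N , indices≤-unique N , vanishing , expansion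
    where
    open ≈-Reasoning
    N : ℕ
    N = degree u
    vanishing : ∀ k → k ∉ indices≤ N → (⟨ A k , u ⟩ ·P B k) ≈P 0P
    vanishing k k∉ w = trans (coeff-·P _ (B k) w) (trans (*-congʳ
      (pairing-homogeneous (A k) u (A-homogeneous k) (ℕ.≰⇒> (k∉ ∘ ∈-indices≤ N k)))) (zeroˡ _))
    expansion : u ≈P ΣP (indices≤ N) (λ k → ⟨ A k , u ⟩ ·P B k)
    expansion v = begin
      coeff u v
        ≈⟨ coeff-eval u v ⟩
      eval u (δ v)
        ≈⟨ eval-congᴬ u (All.map (λ |w|≤N → sym (A-resolution N _ v |w|≤N)) (degree-bound u)) ⟩
      eval u (λ w → ∑[ k ← indices≤ N ] coeff (A k) w * coeff (B k) v)
        ≈⟨ eval-∑ u (indices≤ N) _ ⟩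
      ∑[ k ← indices≤ N ] eval u (λ w → coeff (A k) w * coeff (B k) v)
        ≈⟨ ∑-cong (indices≤ N) (λ k → eval-*ʳ u _ (coeff (A k))) ⟩
      ∑[ k ← indices≤ N ] eval u (coeff (A k)) * coeff (B k) v
        ≈⟨ ∑-cong (indices≤ N) (λ k → *-congʳ (pairing-evalʳ (A k) u)) ⟨
      ∑[ k ← indices≤ N ] ⟨ A k , u ⟩ * coeff (B k) v
        ≈⟨ ∑-cong (indices≤ N) (λ k → coeff-·P _ (B k) v) ⟨
      ∑[ k ← indices≤ N ] coeff (⟨ A k , u ⟩ ·P B k) v
        ≈⟨ coeff-ΣP (indices≤ N) _ v ⟨
      coeff (ΣP (indices≤ N) (λ k → ⟨ A k , u ⟩ ·P B k)) v ∎

corollary2p9 : ∀ {c ℓ : Level} (R : CommutativeRing c ℓ) → IsIntegralDomain R → CharZero R →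
    let open Over R in
    ∀ (u : Poly) →
      FinSumRep u (λ k → ⟨ S k , u ⟩ ·P M k) × FinSumRep u (λ k → ⟨ M k , u ⟩ ·P S k)
corollary2p9 R _ _ u =
  finite-expansion S M S-homogeneous resolution≤ u , finite-expansion M S M-homogeneous resolution≤ᵀ u
  where open Over R
        open Expansion R
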